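{- Let $\Lambda_6$ be the lattice with basis $e_1,\dots,e_6$ and Gram matrix $2\begin{pmatrix}2&-1&0&0&0&0\\-1&2&-1&0&0&0\\0&-1&2&-1&0&-1\\0&0&-1&2&-1&0\\0&0&0&-1&2&0\\0&0&-1&0&0&2\end{pmatrix}$. Every integral lattice $M$ in $\mathbb{R}\Lambda_6$ with $\Lambda_6\subseteq M$ is isometric to one of the six lattices $\Lambda_6$, $\Lambda_6(\tfrac12 e_1)$, $\Lambda_6(\tfrac12(e_1+e_3))$, $\Lambda_6(\tfrac12 e_1,\tfrac12 e_3)$, $\Lambda_6(\tfrac12(e_1+e_3),\tfrac12(e_1+e_5))$, $\Lambda_6(\tfrac12 e_1,\tfrac12 e_3,\tfrac12 e_5)$.
   Context: A lattice is integral if all inner products of its vectors are integers. For a lattice $L$ and vectors $x_1,\dots,x_k$ in $\mathbb{R}L$, $L(x_1,\dots,x_k)$ denotes the lattice generated by $L$ and the $x_i$.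
   Formalization: The vectors of $\mathbb{R}\Lambda_6$ are taken with rational coordinates with respect to $e_1,\dots,e_6$, so the lattices M have rational generators and the isometries are taken ℚ-linear. -}

module Defs where

open import Data.Nat using (ℕ; zero; suc)
open import Data.Integer using (ℤ; +_; -[1+_])
open import Data.Fin using (Fin; zero; suc)
open import Data.Vec using (Vec; []; _∷_; lookup)
open import Data.Rational using (ℚ; _+_; _*_; _/_; 0ℚ; 1ℚ; ½)
open import Data.Product using (Σ; ∃; _×_)
open import Relation.Binary.PropositionalEquality using (_≡_)

-- Vectors of ℚΛ₆ = ℚ-span of e₁..e₆, written in coordinates w.r.t. the basis e₁..e₆.
-- (Every integral lattice M ⊇ Λ₆ lies in the dual Λ₆^#, which is inside ℚΛ₆.)
V : Set
V = Fin 6 → ℚ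

ι : ℤ → ℚ
ι z = z / 1

Σℚ : (n : ℕ) → (Fin n → ℚ) → ℚ
Σℚ zero    f = 0ℚ
Σℚ (suc n) f = f zero + Σℚ n (λ i → f (suc i))

gramRows : Vec (Vec ℤ 6) 6
gramRows =
  (+ 4 ∷ -[1+ 1 ] ∷ + 0 ∷ + 0 ∷ + 0 ∷ + 0 ∷ []) ∷
  (-[1+ 1 ] ∷ + 4 ∷ -[1+ 1 ] ∷ + 0 ∷ + 0 ∷ + 0 ∷ []) ∷
  (+ 0 ∷ -[1+ 1 ] ∷ + 4 ∷ -[1+ 1 ] ∷ + 0 ∷ -[1+ 1 ] ∷ []) ∷
  (+ 0 ∷ + 0 ∷ -[1+ 1 ] ∷ + 4 ∷ -[1+ 1 ] ∷ + 0 ∷ []) ∷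
  (+ 0 ∷ + 0 ∷ + 0 ∷ -[1+ 1 ] ∷ + 4 ∷ + 0 ∷ []) ∷
  (+ 0 ∷ + 0 ∷ -[1+ 1 ] ∷ + 0 ∷ + 0 ∷ + 4 ∷ []) ∷ []

Gram : Fin 6 → Fin 6 → ℤ
Gram i j = lookup (lookup gramRows i) j

b : V → V → ℚ
b x y = Σℚ 6 (λ i → Σℚ 6 (λ j → x i * (ι (Gram i j) * y j)))

δ : {n : ℕ} → Fin n → Fin n → ℚ
δ zero    zero    = 1ℚ
δ zero    (suc _) = 0ℚ
δ (suc _) zero    = 0ℚ
δ (suc i) (suc j) = δ i j

e : Fin 6 → V
e i j = δ i j

_+ᵥ_ : V → V → V
(x +ᵥ y) i = x i + y i

_·_ : ℚ → V → V
(q · x) i = q * x i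

_≈_ : V → V → Set
x ≈ y = ∀ i → x i ≡ y i

-- A finite family of extra generators x₁..x_k ∈ ℚΛ₆ ; it presents the lattice Λ₆(x₁,…,x_k).
record Gens : Set where
  constructor gens
  field
    k  : ℕ
    xs : Fin k → V
open Gens public

_∈_ : V → Gens → Set
v ∈ g = Σ (Fin 6 → ℤ) λ a → Σ (Fin (k g) → ℤ) λ c →
  ∀ t → v t ≡ Σℚ 6 (λ i → ι (a i) * e i t) + Σℚ (k g) (λ j → ι (c j) * xs g j t)

IsInt : ℚ → Set
IsInt q = ∃ λ (z : ℤ) → q ≡ ι z

Integral : Gens → Set
Integral g = ∀ v w → v ∈ g → w ∈ g → IsInt (b v w)

Isometric : Gens → Gens → Set
Isometric M N = Σ (Fin 6 → Fin 6 → ℚ) λ σ →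
  let app : V → V
      app v i = Σℚ 6 (λ j → σ i j * v j)
  in (∀ v → v ∈ M → app v ∈ N)
   × (∀ w → w ∈ N → Σ V λ v → v ∈ M × app v ≈ w)
   × (∀ v w → v ∈ M → w ∈ M → b (app v) (app w) ≡ b v w)

-- the six lattices (indices 0..5 stand for e₁..e₆)
e₁ e₃ e₅ : V
e₁ = e zero
e₃ = e (suc (suc zero))
e₅ = e (suc (suc (suc (suc zero))))

L0 L1 L2 L3 L4 L5 : Gens
L0 = gens 0 (λ ())
L1 = gens 1 (λ _ → ½ · e₁)
L2 = gens 1 (λ _ → ½ · (e₁ +ᵥ e₃))
L3 = gens 2 (λ { zero → ½ · e₁ ; (suc _) → ½ · e₃ })
L4 = gens 2 (λ { zero → ½ · (e₁ +ᵥ e₃) ; (suc _) → ½ · (e₁ +ᵥ e₅) })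
L5 = gens 3 (λ { zero → ½ · e₁ ; (suc zero) → ½ · e₃ ; (suc (suc _)) → ½ · e₅ })

-- The Gram matrix of Λ₆ is 2C, with C the Cartan matrix of E₆, and adj C ≡ ττᵀ (mod 3) for a single
-- vector τ. If M ⊇ Λ₆ is integral and z ∈ M, then m = (b(z, eₖ))ₖ is integral and 6z = adj C · m;
-- integrality of b(z, z) = m · adj C · m / 6 forces 3 ∣ τ · m, hence 3 ∣ adj C · m and z ∈ ½Λ₆.
-- So M/Λ₆ is a subspace of ½Λ₆/Λ₆ ≅ 𝔽₂⁶ on which the pairing (x, y) ↦ xᵀCy is even. The
-- reflections in the roots eᵢ preserve Λ₆; adjoining the generators of M one at a time, a finite
-- table of reflection words, checked by evaluation, carries each intermediate lattice onto one of
-- six normal forms, and these are the six lattices of the theorem.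

module Submission where

open import Algebra.Bundles using (Ring)
import Algebra.Properties.Semiring.Sum as SemiringSum
open import Data.Bool as Bool using (Bool; true; false; T; not; _∧_; _∨_; _xor_; if_then_else_)
open import Data.Bool.ListAction using (all; any)
open import Data.Bool.Properties using (T-∧; T-∨; T-not-≡)
open import Data.Empty using (⊥-elim)
open import Data.Fin as Fin using (Fin; zero; suc; #_)
open import Data.Fin.Properties using (all?)
open import Data.Integer as ℤ using (ℤ; +_; -[1+_])
open import Data.Integer.Divisibility.Signed
  using (_∣_; divides; _∣?_; ∣ᵤ⇒∣; ∣⇒∣ᵤ; ∣-refl; ∣m+n∣m⇒∣n; ∣m⇒∣m*n; ∣m∣n⇒∣m+n)
open import Data.Integer.DivMod using (a≡a%ℕn+[a/ℕn]*n; n%ℕd<d)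
import Data.Integer.Properties as ℤP
open import Data.List using (List; []; _∷_; length)
open import Data.Nat as ℕ using (ℕ; zero; suc)
import Data.Nat.Coprimality as Coprime
open import Data.Nat.Divisibility using () renaming (_∣_ to _ℕ∣_)
open import Data.Nat.Primality using (Prime; prime?; euclidsLemma)
open import Data.Product using (∃; _×_; _,_; proj₁; proj₂)
open import Data.Rational using (ℚ; _+_; _*_; -_; _/_; 0ℚ; 1ℚ; ½; mkℚ; ↥_)
import Data.Rational.Properties as ℚP
open import Data.Rational.Solver using (module +-*-Solver)
open import Data.Sum using (_⊎_; inj₁; inj₂; reduce)
open import Data.Unit using (tt)
open import Data.Vec using (Vec; []; _∷_; lookup; tabulate; map; zipWith; replicate; updateAt)
import Data.Vec.Properties as VecP
open import Data.Vec.Functional using (tail) renaming (_∷_ to _∷ᶠ_)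
open import Function using (_∘_)
open import Function.Bundles using (Equivalence)
open import Relation.Binary.PropositionalEquality
  using (_≡_; refl; sym; trans; cong; cong₂; subst; module ≡-Reasoning)
open import Relation.Nullary.Decidable using (True; toWitness; fromWitness; from-yes; isYes)

open import Defs

open +-*-Solver using (solve; _:=_; con; _:+_; _:*_; :-_)
open SemiringSum (Ring.semiring ℚP.+-*-ring)
  using (sum; sum-cong-≗; ∑-distrib-+; ∑-comm; *-distribˡ-sum; sum-replicate-zero)
module ℤΣ = SemiringSum ℤP.+-*-semiring

-- ι z = z / 1 normalises to this fraction, so the ring laws for ι below hold by computation.
ι-normal : ∀ z → ι z ≡ mkℚ z 0 (Coprime.sym (Coprime.1-coprimeTo ℤ.∣ z ∣))
ι-normal z = ℚP.fromℚᵘ-toℚᵘ (mkℚ z 0 (Coprime.sym (Coprime.1-coprimeTo ℤ.∣ z ∣)))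

ι-homo-+ : ∀ a c → ι (a ℤ.+ c) ≡ ι a + ι c
ι-homo-+ a c rewrite ι-normal a | ι-normal c =
  cong (_/ 1) (cong₂ ℤ._+_ (sym (ℤP.*-identityʳ a)) (sym (ℤP.*-identityʳ c)))

ι-homo-* : ∀ a c → ι (a ℤ.* c) ≡ ι a * ι c
ι-homo-* a c rewrite ι-normal a | ι-normal c = refl

ι-injective : ∀ {a c} → ι a ≡ ι c → a ≡ c
ι-injective {a} {c} p rewrite ι-normal a | ι-normal c = cong ↥_ p

ι-homo‿- : ∀ a → ι (ℤ.- a) ≡ - ι a
ι-homo‿- a = begin
  ι (ℤ.- a)                  ≡⟨ solve 2 (λ x y → x := (x :+ y) :+ (:- y)) refl (ι (ℤ.- a)) (ι a) ⟩
  (ι (ℤ.- a) + ι a) + - ι a  ≡⟨ cong (_+ - ι a) (sym (ι-homo-+ (ℤ.- a) a)) ⟩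
  ι (ℤ.- a ℤ.+ a) + - ι a    ≡⟨ cong (λ w → ι w + - ι a) (ℤP.+-inverseˡ a) ⟩
  0ℚ + - ι a                 ≡⟨ ℚP.+-identityˡ (- ι a) ⟩
  - ι a                      ∎
  where open ≡-Reasoning

Σℚ≡sum : ∀ n f → Σℚ n f ≡ sum f
Σℚ≡sum zero    f = refl
Σℚ≡sum (suc n) f = cong (_+_ (f zero)) (Σℚ≡sum n (tail f))

Σℚ-cong : ∀ n {f g : Fin n → ℚ} → (∀ j → f j ≡ g j) → Σℚ n f ≡ Σℚ n g
Σℚ-cong n {f} {g} p = trans (Σℚ≡sum n f) (trans (sum-cong-≗ p) (sym (Σℚ≡sum n g)))

ι-homo-sum : ∀ n (h : Fin n → ℤ) → Σℚ n (λ i → ι (h i)) ≡ ι (ℤΣ.sum h)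
ι-homo-sum zero    h = refl
ι-homo-sum (suc n) h =
  trans (cong (_+_ (ι (h zero))) (ι-homo-sum n (tail h))) (sym (ι-homo-+ (h zero) _))

δ-sym : ∀ {n} (i j : Fin n) → δ i j ≡ δ j i
δ-sym zero    zero    = refl
δ-sym zero    (suc j) = refl
δ-sym (suc i) zero    = refl
δ-sym (suc i) (suc j) = δ-sym i j

∑-δ : ∀ n (l : Fin n) (h : Fin n → ℚ) → Σℚ n (λ j → δ l j * h j) ≡ h l
∑-δ (suc n) zero h = begin
  1ℚ * h zero + Σℚ n (λ j → 0ℚ * h (suc j))
    ≡⟨ cong₂ _+_ (ℚP.*-identityˡ (h zero)) (trans (Σℚ≡sum n _) (sum-cong-≗ (λ j → ℚP.*-zeroˡ (h (suc j))))) ⟩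
  h zero + sum {n} (λ _ → 0ℚ)
    ≡⟨ cong (_+_ (h zero)) (sum-replicate-zero n) ⟩
  h zero + 0ℚ
    ≡⟨ ℚP.+-identityʳ (h zero) ⟩
  h zero ∎
  where open ≡-Reasoning
∑-δ (suc n) (suc l) h =
  trans (cong₂ _+_ (ℚP.*-zeroˡ (h zero)) (∑-δ n l (tail h))) (ℚP.+-identityˡ (h (suc l)))

0ᵥ : V
0ᵥ _ = 0ℚ

≈-refl : ∀ {v} → v ≈ v
≈-refl _ = refl

≈-sym : ∀ {v w} → v ≈ w → w ≈ v
≈-sym p i = sym (p i)

≈-trans : ∀ {u v w} → u ≈ v → v ≈ w → u ≈ w
≈-trans p q i = trans (p i) (q i)

+ᵥ-cong : ∀ {v v′ w w′} → v ≈ v′ → w ≈ w′ → (v +ᵥ w) ≈ (v′ +ᵥ w′)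
+ᵥ-cong p q i = cong₂ _+_ (p i) (q i)

·-cong : ∀ q {v w} → v ≈ w → (q · v) ≈ (q · w)
·-cong q p i = cong (q *_) (p i)

Gram-sym : ∀ i j → Gram i j ≡ Gram j i
Gram-sym = toWitness {a? = all? λ i → all? λ j → Gram i j ℤ.≟ Gram j i} _

b-cong : ∀ {x x′ y y′} → x ≈ x′ → y ≈ y′ → b x y ≡ b x′ y′
b-cong px py = sum-cong-≗ λ i → sum-cong-≗ λ j →
  cong₂ (λ u w → u * (ι (Gram i j) * w)) (px i) (py j)

b-+ˡ : ∀ x x′ y → b (x +ᵥ x′) y ≡ b x y + b x′ y
b-+ˡ x x′ y = begin
  b (x +ᵥ x′) y
    ≡⟨ sum-cong-≗ (λ i → sum-cong-≗ λ j → ℚP.*-distribʳ-+ (ι (Gram i j) * y j) (x i) (x′ i)) ⟩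
  sum (λ i → sum λ j → term x i j + term x′ i j)
    ≡⟨ sum-cong-≗ (λ i → ∑-distrib-+ (term x i) (term x′ i)) ⟩
  sum (λ i → sum (term x i) + sum (term x′ i))
    ≡⟨ ∑-distrib-+ (λ i → sum (term x i)) (λ i → sum (term x′ i)) ⟩
  b x y + b x′ y ∎
  where
  open ≡-Reasoning
  term : V → Fin 6 → Fin 6 → ℚ
  term u i j = u i * (ι (Gram i j) * y j)

b-·ˡ : ∀ q x y → b (q · x) y ≡ q * b x y
b-·ˡ q x y = sym (begin
  q * b x y
    ≡⟨ *-distribˡ-sum q (λ i → sum (λ j → x i * (ι (Gram i j) * y j))) ⟩
  sum (λ i → q * sum (λ j → x i * (ι (Gram i j) * y j)))
    ≡⟨ sum-cong-≗ (λ i → *-distribˡ-sum q (λ j → x i * (ι (Gram i j) * y j))) ⟩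
  sum (λ i → sum (λ j → q * (x i * (ι (Gram i j) * y j))))
    ≡⟨ sum-cong-≗ (λ i → sum-cong-≗ λ j → sym (ℚP.*-assoc q (x i) (ι (Gram i j) * y j))) ⟩
  b (q · x) y ∎)
  where open ≡-Reasoning

b-sym : ∀ x y → b x y ≡ b y x
b-sym x y = trans (∑-comm (λ i j → x i * (ι (Gram i j) * y j)))
  (sum-cong-≗ λ j → sum-cong-≗ λ i →
    trans (swap (x i) (ι (Gram i j)) (y j)) (cong (λ g → y j * (ι g * x i)) (Gram-sym i j)))
  where
  swap : ∀ u g w → u * (g * w) ≡ w * (g * u)
  swap = solve 3 (λ u g w → u :* (g :* w) := w :* (g :* u)) refl

b-+ʳ : ∀ x y y′ → b x (y +ᵥ y′) ≡ b x y + b x y′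
b-+ʳ x y y′ = trans (b-sym x (y +ᵥ y′)) (trans (b-+ˡ y y′ x) (cong₂ _+_ (b-sym y x) (b-sym y′ x)))

b-·ʳ : ∀ q x y → b x (q · y) ≡ q * b x y
b-·ʳ q x y = trans (b-sym x (q · y)) (trans (b-·ˡ q y x) (cong (q *_) (b-sym y x)))

b-e : ∀ x k → b x (e k) ≡ Σℚ 6 (λ i → x i * ι (Gram i k))
b-e x k = sum-cong-≗ λ i → begin
  Σℚ 6 (λ j → x i * (ι (Gram i j) * δ k j))  ≡⟨ sum-cong-≗ (λ j → rearrange (x i) (ι (Gram i j)) (δ k j)) ⟩
  Σℚ 6 (λ j → δ k j * (x i * ι (Gram i j)))  ≡⟨ ∑-δ 6 k (λ j → x i * ι (Gram i j)) ⟩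
  x i * ι (Gram i k)                          ∎
  where
  open ≡-Reasoning
  rearrange : ∀ u g d → u * (g * d) ≡ d * (u * g)
  rearrange = solve 3 (λ u g d → u :* (g :* d) := d :* (u :* g)) refl

b-expandʳ : ∀ x y → b x y ≡ Σℚ 6 (λ j → y j * b x (e j))
b-expandʳ x y = trans (∑-comm (λ i j → x i * (ι (Gram i j) * y j))) (sum-cong-≗ λ j → begin
  Σℚ 6 (λ i → x i * (ι (Gram i j) * y j))  ≡⟨ sum-cong-≗ (λ i → rearrange (x i) (ι (Gram i j)) (y j)) ⟩
  Σℚ 6 (λ i → y j * (x i * ι (Gram i j)))  ≡⟨ sym (*-distribˡ-sum (y j) (λ i → x i * ι (Gram i j))) ⟩
  y j * Σℚ 6 (λ i → x i * ι (Gram i j))    ≡⟨ cong (y j *_) (sym (b-e x j)) ⟩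
  y j * b x (e j)                           ∎)
  where
  open ≡-Reasoning
  rearrange : ∀ u g w → u * (g * w) ≡ w * (u * g)
  rearrange = solve 3 (λ u g w → u :* (g :* w) := w :* (u :* g)) refl

record IsLinear (f : V → V) : Set where
  field
    cong≈  : ∀ {v w} → v ≈ w → f v ≈ f w
    homo-+ : ∀ v w → f (v +ᵥ w) ≈ (f v +ᵥ f w)
    homo-· : ∀ q v → f (q · v) ≈ (q · f v)
open IsLinear

id-linear : IsLinear (λ v → v)
id-linear = record { cong≈ = λ p → p ; homo-+ = λ _ _ → ≈-refl ; homo-· = λ _ _ → ≈-refl }

∘-linear : ∀ {f g} → IsLinear f → IsLinear g → IsLinear (λ v → f (g v))
∘-linear {f} {g} F G = record
  { cong≈  = λ p → cong≈ F (cong≈ G p)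
  ; homo-+ = λ v w → ≈-trans (cong≈ F (homo-+ G v w)) (homo-+ F (g v) (g w))
  ; homo-· = λ q v → ≈-trans (cong≈ F (homo-· G q v)) (homo-· F q (g v))
  }

linear-0ᵥ : ∀ {f} → IsLinear f → f 0ᵥ ≈ 0ᵥ
linear-0ᵥ {f} F t =
  trans (cong≈ F {0ᵥ} {0ℚ · 0ᵥ} (λ _ → refl) t) (trans (homo-· F 0ℚ 0ᵥ t) (ℚP.*-zeroˡ (f 0ᵥ t)))

Σᵥ : (n : ℕ) → (Fin n → V) → V
Σᵥ n w t = Σℚ n (λ j → w j t)

linear-Σᵥ : ∀ {f} → IsLinear f → ∀ n (w : Fin n → V) → f (Σᵥ n w) ≈ Σᵥ n (λ j → f (w j))
linear-Σᵥ F zero    w = linear-0ᵥ F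
linear-Σᵥ {f} F (suc n) w = ≈-trans (homo-+ F (w zero) (Σᵥ n (tail w)))
  (+ᵥ-cong {f (w zero)} ≈-refl (linear-Σᵥ F n (tail w)))

basis-expansion : ∀ v → v ≈ Σᵥ 6 (λ j → v j · e j)
basis-expansion v t = sym (trans (sum-cong-≗ (λ j → cong (v j *_) (δ-sym j t)))
  (trans (sum-cong-≗ λ j → ℚP.*-comm (v j) (δ t j)) (∑-δ 6 t v)))

δℤ : ∀ {n} → Fin n → Fin n → ℤ
δℤ zero    zero    = + 1
δℤ zero    (suc _) = + 0
δℤ (suc _) zero    = + 0
δℤ (suc i) (suc j) = δℤ i j

ι-δℤ : ∀ {n} (i j : Fin n) → ι (δℤ i j) ≡ δ i j
ι-δℤ zero    zero    = refl
ι-δℤ zero    (suc j) = refl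
ι-δℤ (suc i) zero    = refl
ι-δℤ (suc i) (suc j) = ι-δℤ i j

ιᶠ : (Fin 6 → ℤ) → V
ιᶠ a t = ι (a t)

combination : (n : ℕ) → (Fin n → ℤ) → (Fin n → V) → V
combination n c xs t = Σℚ n (λ j → ι (c j) * xs j t)

combination-+ : ∀ n c c′ xs →
  combination n (λ j → c j ℤ.+ c′ j) xs ≈ (combination n c xs +ᵥ combination n c′ xs)
combination-+ n c c′ xs t = begin
  Σℚ n (λ j → ι (c j ℤ.+ c′ j) * xs j t)
    ≡⟨ Σℚ≡sum n _ ⟩
  sum (λ j → ι (c j ℤ.+ c′ j) * xs j t)
    ≡⟨ sum-cong-≗ (λ j → trans (cong (_* xs j t) (ι-homo-+ (c j) (c′ j))) (ℚP.*-distribʳ-+ (xs j t) (ι (c j)) (ι (c′ j)))) ⟩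
  sum (λ j → ι (c j) * xs j t + ι (c′ j) * xs j t)
    ≡⟨ ∑-distrib-+ (λ j → ι (c j) * xs j t) (λ j → ι (c′ j) * xs j t) ⟩
  sum (λ j → ι (c j) * xs j t) + sum (λ j → ι (c′ j) * xs j t)
    ≡⟨ sym (cong₂ _+_ (Σℚ≡sum n _) (Σℚ≡sum n _)) ⟩
  combination n c xs t + combination n c′ xs t ∎
  where open ≡-Reasoning

combination-* : ∀ n d c xs → combination n (λ j → d ℤ.* c j) xs ≈ (ι d · combination n c xs)
combination-* n d c xs t = begin
  Σℚ n (λ j → ι (d ℤ.* c j) * xs j t)
    ≡⟨ Σℚ≡sum n _ ⟩
  sum (λ j → ι (d ℤ.* c j) * xs j t)
    ≡⟨ sum-cong-≗ (λ j → trans (cong (_* xs j t) (ι-homo-* d (c j))) (ℚP.*-assoc (ι d) (ι (c j)) (xs j t))) ⟩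
  sum (λ j → ι d * (ι (c j) * xs j t))
    ≡⟨ sym (*-distribˡ-sum (ι d) (λ j → ι (c j) * xs j t)) ⟩
  ι d * sum (λ j → ι (c j) * xs j t)
    ≡⟨ cong (ι d *_) (sym (Σℚ≡sum n _)) ⟩
  ι d * combination n c xs t ∎
  where open ≡-Reasoning

combination-δ : ∀ n l (xs : Fin n → V) → combination n (δℤ l) xs ≈ xs l
combination-δ n l xs t =
  trans (Σℚ-cong n (λ j → cong (_* xs j t) (ι-δℤ l j))) (∑-δ n l (λ j → xs j t))

combination-e : ∀ a → combination 6 a e ≈ ιᶠ a
combination-e a t =
  trans (sum-cong-≗ (λ i → trans (ℚP.*-comm (ι (a i)) (δ i t)) (cong (_* ι (a i)) (δ-sym i t))))
        (∑-δ 6 t (ιᶠ a))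

∈-resp-≈ : ∀ {L v w} → v ≈ w → v ∈ L → w ∈ L
∈-resp-≈ v≈w (a , c , p) = a , c , λ t → trans (sym (v≈w t)) (p t)

∈-+ : ∀ {L v w} → v ∈ L → w ∈ L → (v +ᵥ w) ∈ L
∈-+ {gens k xs} {v} {w} (a , c , p) (a′ , c′ , p′) =
  (λ i → a i ℤ.+ a′ i) , (λ j → c j ℤ.+ c′ j) , λ t → begin
    v t + w t
      ≡⟨ cong₂ _+_ (p t) (p′ t) ⟩
    (combination 6 a e t + combination k c xs t) + (combination 6 a′ e t + combination k c′ xs t)
      ≡⟨ interchange (combination 6 a e t) (combination k c xs t) (combination 6 a′ e t) (combination k c′ xs t) ⟩
    (combination 6 a e t + combination 6 a′ e t) + (combination k c xs t + combination k c′ xs t)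
      ≡⟨ sym (cong₂ _+_ (combination-+ 6 a a′ e t) (combination-+ k c c′ xs t)) ⟩
    combination 6 (λ i → a i ℤ.+ a′ i) e t + combination k (λ j → c j ℤ.+ c′ j) xs t ∎
  where
  open ≡-Reasoning
  interchange : ∀ p q r s → (p + q) + (r + s) ≡ (p + r) + (q + s)
  interchange = solve 4 (λ p q r s → (p :+ q) :+ (r :+ s) := (p :+ r) :+ (q :+ s)) refl

∈-· : ∀ {L v} d → v ∈ L → (ι d · v) ∈ L
∈-· {gens k xs} {v} d (a , c , p) =
  (λ i → d ℤ.* a i) , (λ j → d ℤ.* c j) , λ t → begin
    ι d * v t
      ≡⟨ cong (ι d *_) (p t) ⟩
    ι d * (combination 6 a e t + combination k c xs t)
      ≡⟨ ℚP.*-distribˡ-+ (ι d) _ _ ⟩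
    ι d * combination 6 a e t + ι d * combination k c xs t
      ≡⟨ sym (cong₂ _+_ (combination-* 6 d a e t) (combination-* k d c xs t)) ⟩
    combination 6 (λ i → d ℤ.* a i) e t + combination k (λ j → d ℤ.* c j) xs t ∎
  where open ≡-Reasoning

combination-zero : ∀ n (xs : Fin n → V) → combination n (λ _ → + 0) xs ≈ 0ᵥ
combination-zero n xs t = trans (Σℚ-cong n (λ j → ℚP.*-zeroˡ (xs j t)))
  (trans (Σℚ≡sum n _) (sum-replicate-zero n))

ιᶠ∈ : ∀ {L} a → ιᶠ a ∈ L
ιᶠ∈ {gens k xs} a = a , (λ _ → + 0) , λ t → sym (begin
  combination 6 a e t + combination k (λ _ → + 0) xs t
    ≡⟨ cong₂ _+_ (combination-e a t) (combination-zero k xs t) ⟩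
  ι (a t) + 0ℚ
    ≡⟨ ℚP.+-identityʳ (ι (a t)) ⟩
  ι (a t) ∎)
  where open ≡-Reasoning

0ᵥ∈ : ∀ {L} → 0ᵥ ∈ L
0ᵥ∈ {L} = ιᶠ∈ {L} (λ _ → + 0)

e∈ : ∀ {L} i → e i ∈ L
e∈ {L} i = ∈-resp-≈ {L} (λ t → ι-δℤ i t) (ιᶠ∈ {L} (δℤ i))

generator∈ : ∀ {k} (xs : Fin k → V) l → xs l ∈ gens k xs
generator∈ {k} xs l = (λ _ → + 0) , δℤ l , λ t → sym (begin
  combination 6 (λ _ → + 0) e t + combination k (δℤ l) xs t
    ≡⟨ cong₂ _+_ (combination-zero 6 e t) (combination-δ k l xs t) ⟩
  0ℚ + xs l t
    ≡⟨ ℚP.+-identityˡ (xs l t) ⟩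
  xs l t ∎)
  where open ≡-Reasoning

∈-tail : ∀ {k} (xs : Fin (suc k) → V) {v} → v ∈ gens k (tail xs) → v ∈ gens (suc k) xs
∈-tail {k} xs (a , c , p) = a , (+ 0 ∷ᶠ c) , λ t →
  trans (p t) (cong (_+_ (combination 6 a e t)) (sym (drop-head t)))
  where
  drop-head : ∀ t → ι (+ 0) * xs zero t + combination k c (tail xs) t ≡ combination k c (tail xs) t
  drop-head t = trans (cong (_+ combination k c (tail xs) t) (ℚP.*-zeroˡ (xs zero t)))
                      (ℚP.+-identityˡ (combination k c (tail xs) t))

map-combination∈ : ∀ {L f} → IsLinear f → ∀ n c (xs : Fin n → V) →
  (∀ j → f (xs j) ∈ L) → f (combination n c xs) ∈ L
map-combination∈ {L} F zero    c xs fx = ∈-resp-≈ {L} (≈-sym (linear-0ᵥ F)) (0ᵥ∈ {L})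
map-combination∈ {L} F (suc n) c xs fx =
  ∈-resp-≈ {L} (≈-sym (≈-trans (homo-+ F _ _) (+ᵥ-cong (homo-· F (ι (c zero)) (xs zero)) ≈-refl)))
    (∈-+ {L} (∈-· {L} (c zero) (fx zero)) (map-combination∈ {L} F n (tail c) (tail xs) (λ j → fx (suc j))))

map-⊆ : ∀ {L f k} {xs : Fin k → V} → IsLinear f → (∀ i → f (e i) ∈ L) → (∀ l → f (xs l) ∈ L) →
  ∀ {v} → v ∈ gens k xs → f v ∈ L
map-⊆ {L} {k = k} {xs} F fe fx (a , c , p) =
  ∈-resp-≈ {L} (≈-sym (≈-trans (cong≈ F p) (homo-+ F (combination 6 a e) (combination k c xs))))
    (∈-+ {L} (map-combination∈ {L} F 6 a e fe) (map-combination∈ {L} F k c xs fx))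

_⊆_ : Gens → Gens → Set
A ⊆ B = ∀ {v} → v ∈ A → v ∈ B

integral-⊆ : ∀ {A B} → A ⊆ B → Integral B → Integral A
integral-⊆ A⊆B intB v w v∈A w∈A = intB v w (A⊆B v∈A) (A⊆B w∈A)

⊆-by-generators : ∀ {k k′} {xs : Fin k → V} {xs′ : Fin k′ → V} →
  (∀ l → xs l ∈ gens k′ xs′) → gens k xs ⊆ gens k′ xs′
⊆-by-generators xs∈ = map-⊆ id-linear e∈ xs∈

record Isometry : Set where
  field
    to from     : V → V
    to-linear   : IsLinear to
    from-linear : IsLinear from
    to-b        : ∀ v w → b (to v) (to w) ≡ b v w
    from∘to     : ∀ v → from (to v) ≈ v
    to∘from     : ∀ v → to (from v) ≈ v

id-isometry : Isometry
id-isometry = record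
  { to = λ v → v ; from = λ v → v ; to-linear = id-linear ; from-linear = id-linear
  ; to-b = λ _ _ → refl ; from∘to = λ _ → ≈-refl ; to∘from = λ _ → ≈-refl }

_∘ᵢ_ : Isometry → Isometry → Isometry
φ ∘ᵢ ψ = record
  { to          = λ v → φ.to (ψ.to v)
  ; from        = λ v → ψ.from (φ.from v)
  ; to-linear   = ∘-linear φ.to-linear ψ.to-linear
  ; from-linear = ∘-linear ψ.from-linear φ.from-linear
  ; to-b        = λ v w → trans (φ.to-b (ψ.to v) (ψ.to w)) (ψ.to-b v w)
  ; from∘to     = λ v → ≈-trans (cong≈ ψ.from-linear (φ.from∘to (ψ.to v))) (ψ.from∘to v)
  ; to∘from     = λ v → ≈-trans (cong≈ φ.to-linear (ψ.to∘from (φ.from v))) (φ.to∘from v)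
  }
  where
  module φ = Isometry φ
  module ψ = Isometry ψ

-- Isometric of Defs, with the linear map and its inverse given as functions rather than a matrix.
record _≅_ (A B : Gens) : Set where
  field
    isometry : Isometry
  open Isometry isometry public
  field
    to-∈   : ∀ {v} → v ∈ A → to v ∈ B
    from-∈ : ∀ {w} → w ∈ B → from w ∈ A

≅-by-generators : ∀ {k k′} {xs : Fin k → V} {xs′ : Fin k′ → V} (φ : Isometry) →
  (∀ i → Isometry.to φ (e i) ∈ gens k′ xs′) → (∀ l → Isometry.to φ (xs l) ∈ gens k′ xs′) →
  (∀ i → Isometry.from φ (e i) ∈ gens k xs) → (∀ l → Isometry.from φ (xs′ l) ∈ gens k xs) →
  gens k xs ≅ gens k′ xs′
≅-by-generators φ to-e to-xs from-e from-xs′ = record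
  { isometry = φ
  ; to-∈     = map-⊆ (Isometry.to-linear φ) to-e to-xs
  ; from-∈   = map-⊆ (Isometry.from-linear φ) from-e from-xs′
  }

≅-trans : ∀ {A B C} → A ≅ B → B ≅ C → A ≅ C
≅-trans I J = record
  { isometry = J.isometry ∘ᵢ I.isometry
  ; to-∈     = λ v∈A → J.to-∈ (I.to-∈ v∈A)
  ; from-∈   = λ w∈C → I.from-∈ (J.from-∈ w∈C)
  }
  where
  module I = _≅_ I
  module J = _≅_ J

isInt-resp : ∀ {p q} → p ≡ q → IsInt q → IsInt p
isInt-resp p≡q (z , q≡z) = z , trans p≡q q≡z

≅-integral : ∀ {A B} → A ≅ B → Integral A → Integral B
≅-integral I intA v w v∈B w∈B =
  isInt-resp (trans (b-cong (≈-sym (I.to∘from v)) (≈-sym (I.to∘from w))) (I.to-b (I.from v) (I.from w)))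
    (intA (I.from v) (I.from w) (I.from-∈ v∈B) (I.from-∈ w∈B))
  where module I = _≅_ I

≅-extend : ∀ {j k} {ys : Fin (suc j) → V} {xs : Fin k → V} (I : gens j (tail ys) ≅ gens k xs) →
  gens (suc j) ys ≅ gens (suc k) (_≅_.to I (ys zero) ∷ᶠ xs)
≅-extend {ys = ys} {xs} I = ≅-by-generators I.isometry
  (λ i → ∈-tail xs⁺ (I.to-∈ (e∈ i)))
  (λ { zero → generator∈ xs⁺ zero ; (suc l) → ∈-tail xs⁺ (I.to-∈ (generator∈ (tail ys) l)) })
  (λ i → ∈-tail ys (I.from-∈ (e∈ i)))
  (λ { zero → ∈-resp-≈ {gens _ ys} (≈-sym (I.from∘to (ys zero))) (generator∈ ys zero)
     ; (suc l) → ∈-tail ys (I.from-∈ (generator∈ xs l)) })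
  where
  module I = _≅_ I
  xs⁺ : Fin (suc _) → V
  xs⁺ = I.to (ys zero) ∷ᶠ xs

≅-head-modΛ : ∀ {k z z′} {xs : Fin k → V} a → z ≈ (z′ +ᵥ ιᶠ a) →
  gens (suc k) (z ∷ᶠ xs) ≅ gens (suc k) (z′ ∷ᶠ xs)
≅-head-modΛ {k} {z} {z′} {xs} a z≈ = ≅-by-generators id-isometry (e∈ {L′})
  (λ { zero → ∈-resp-≈ {L′} (≈-sym z≈) (∈-+ {L′} (generator∈ (z′ ∷ᶠ xs) zero) (ιᶠ∈ {L′} a))
     ; (suc l) → generator∈ (z′ ∷ᶠ xs) (suc l) })
  (e∈ {L})
  (λ { zero → ∈-resp-≈ {L} z′≈ (∈-+ {L} (generator∈ (z ∷ᶠ xs) zero) (ιᶠ∈ {L} (λ t → ℤ.- a t)))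
     ; (suc l) → generator∈ (z ∷ᶠ xs) (suc l) })
  where
  L L′ : Gens
  L  = gens (suc k) (z ∷ᶠ xs)
  L′ = gens (suc k) (z′ ∷ᶠ xs)
  z′≈ : (z +ᵥ ιᶠ (λ t → ℤ.- a t)) ≈ z′
  z′≈ t = begin
    z t + ι (ℤ.- a t)          ≡⟨ cong₂ _+_ (z≈ t) (ι-homo‿- (a t)) ⟩
    (z′ t + ι (a t)) + - ι (a t) ≡⟨ solve 2 (λ x y → (x :+ y) :+ (:- y) := x) refl (z′ t) (ι (a t)) ⟩
    z′ t                       ∎
    where open ≡-Reasoning

≅-pointwise : ∀ {k} {xs xs′ : Fin k → V} → (∀ l → xs l ≈ xs′ l) → gens k xs ≅ gens k xs′
≅-pointwise {xs = xs} {xs′} xs≈xs′ = ≅-by-generators id-isometry e∈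
  (λ l → ∈-resp-≈ (≈-sym (xs≈xs′ l)) (generator∈ xs′ l)) e∈
  (λ l → ∈-resp-≈ (xs≈xs′ l) (generator∈ xs l))

≅⇒Isometric : ∀ {A B} → A ≅ B → Isometric A B
≅⇒Isometric {B = B} I = σ
  , (λ v v∈A → ∈-resp-≈ {B} (≈-sym (matrix≈to v)) (I.to-∈ v∈A))
  , (λ w w∈B → I.from w , I.from-∈ w∈B , ≈-trans (matrix≈to (I.from w)) (I.to∘from w))
  , (λ v w _ _ → trans (b-cong (matrix≈to v) (matrix≈to w)) (I.to-b v w))
  where
  module I = _≅_ I
  σ : Fin 6 → Fin 6 → ℚ
  σ i j = I.to (e j) i
  matrix≈to : ∀ v → (λ i → Σℚ 6 (λ j → σ i j * v j)) ≈ I.to v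
  matrix≈to v i = begin
    Σℚ 6 (λ j → I.to (e j) i * v j)
      ≡⟨ sum-cong-≗ (λ j → trans (ℚP.*-comm (I.to (e j) i) (v j)) (sym (homo-· I.to-linear (v j) (e j) i))) ⟩
    Σᵥ 6 (λ j → I.to (v j · e j)) i
      ≡⟨ sym (linear-Σᵥ I.to-linear 6 (λ j → v j · e j) i) ⟩
    I.to (Σᵥ 6 (λ j → v j · e j)) i
      ≡⟨ sym (cong≈ I.to-linear (basis-expansion v) i) ⟩
    I.to v i ∎
    where open ≡-Reasoning

-- The Cartan matrix and the dual lattice

cartanRows : Vec (Vec ℤ 6) 6
cartanRows =
  (+ 2 ∷ -[1+ 0 ] ∷ + 0 ∷ + 0 ∷ + 0 ∷ + 0 ∷ []) ∷
  (-[1+ 0 ] ∷ + 2 ∷ -[1+ 0 ] ∷ + 0 ∷ + 0 ∷ + 0 ∷ []) ∷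
  (+ 0 ∷ -[1+ 0 ] ∷ + 2 ∷ -[1+ 0 ] ∷ + 0 ∷ -[1+ 0 ] ∷ []) ∷
  (+ 0 ∷ + 0 ∷ -[1+ 0 ] ∷ + 2 ∷ -[1+ 0 ] ∷ + 0 ∷ []) ∷
  (+ 0 ∷ + 0 ∷ + 0 ∷ -[1+ 0 ] ∷ + 2 ∷ + 0 ∷ []) ∷
  (+ 0 ∷ + 0 ∷ -[1+ 0 ] ∷ + 0 ∷ + 0 ∷ + 2 ∷ []) ∷ []

Cartan : Fin 6 → Fin 6 → ℤ
Cartan i j = lookup (lookup cartanRows i) j

Gram≡2*Cartan : ∀ i j → Gram i j ≡ + 2 ℤ.* Cartan i j
Gram≡2*Cartan = toWitness {a? = all? λ i → all? λ j → Gram i j ℤ.≟ + 2 ℤ.* Cartan i j} _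

ℤ⁶ : Set
ℤ⁶ = Vec ℤ 6

⟦_⟧ : ℤ⁶ → V
⟦ u ⟧ = ιᶠ (lookup u)

cartanCoord : ℤ⁶ → Fin 6 → ℤ
cartanCoord u i = ℤΣ.sum (λ k → lookup u k ℤ.* Cartan k i)

b-⟦⟧-e : ∀ u i → b ⟦ u ⟧ (e i) ≡ ι (+ 2 ℤ.* cartanCoord u i)
b-⟦⟧-e u i = begin
  b ⟦ u ⟧ (e i)
    ≡⟨ b-e ⟦ u ⟧ i ⟩
  Σℚ 6 (λ k → ι (lookup u k) * ι (Gram k i))
    ≡⟨ sum-cong-≗ (λ k → sym (ι-homo-* (lookup u k) (Gram k i))) ⟩
  Σℚ 6 (λ k → ι (lookup u k ℤ.* Gram k i))
    ≡⟨ ι-homo-sum 6 (λ k → lookup u k ℤ.* Gram k i) ⟩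
  ι (ℤΣ.sum (λ k → lookup u k ℤ.* Gram k i))
    ≡⟨ cong ι (ℤΣ.sum-cong-≗ λ k → trans (cong (lookup u k ℤ.*_) (Gram≡2*Cartan k i)) (exchange (lookup u k) (Cartan k i))) ⟩
  ι (ℤΣ.sum (λ k → + 2 ℤ.* (lookup u k ℤ.* Cartan k i)))
    ≡⟨ cong ι (sym (ℤΣ.*-distribˡ-sum (+ 2) (λ k → lookup u k ℤ.* Cartan k i))) ⟩
  ι (+ 2 ℤ.* cartanCoord u i) ∎
  where
  open ≡-Reasoning
  exchange : ∀ x y → x ℤ.* (+ 2 ℤ.* y) ≡ + 2 ℤ.* (x ℤ.* y)
  exchange x y = trans (sym (ℤP.*-assoc x (+ 2) y)) (trans (cong (ℤ._* y) (ℤP.*-comm x (+ 2))) (ℤP.*-assoc (+ 2) x y))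

adjugateRows : Vec (Vec ℤ 6) 6
adjugateRows =
  (+ 4 ∷ + 5 ∷ + 6 ∷ + 4 ∷ + 2 ∷ + 3 ∷ []) ∷
  (+ 5 ∷ + 10 ∷ + 12 ∷ + 8 ∷ + 4 ∷ + 6 ∷ []) ∷
  (+ 6 ∷ + 12 ∷ + 18 ∷ + 12 ∷ + 6 ∷ + 9 ∷ []) ∷
  (+ 4 ∷ + 8 ∷ + 12 ∷ + 10 ∷ + 5 ∷ + 6 ∷ []) ∷
  (+ 2 ∷ + 4 ∷ + 6 ∷ + 5 ∷ + 4 ∷ + 3 ∷ []) ∷
  (+ 3 ∷ + 6 ∷ + 9 ∷ + 6 ∷ + 3 ∷ + 6 ∷ []) ∷ []

Adj : Fin 6 → Fin 6 → ℤ
Adj i j = lookup (lookup adjugateRows i) j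

Gram*Adj≡6 : ∀ i j → ℤΣ.sum (λ k → Gram i k ℤ.* Adj j k) ≡ + 6 ℤ.* δℤ i j
Gram*Adj≡6 = toWitness {a? = all? λ i → all? λ j → ℤΣ.sum (λ k → Gram i k ℤ.* Adj j k) ℤ.≟ + 6 ℤ.* δℤ i j} _

adjugateQuotientRows : Vec (Vec ℤ 6) 6
adjugateQuotientRows =
  (+ 1 ∷ + 2 ∷ + 2 ∷ + 1 ∷ + 1 ∷ + 1 ∷ []) ∷
  (+ 2 ∷ + 3 ∷ + 4 ∷ + 3 ∷ + 1 ∷ + 2 ∷ []) ∷
  (+ 2 ∷ + 4 ∷ + 6 ∷ + 4 ∷ + 2 ∷ + 3 ∷ []) ∷
  (+ 1 ∷ + 3 ∷ + 4 ∷ + 3 ∷ + 2 ∷ + 2 ∷ []) ∷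
  (+ 1 ∷ + 1 ∷ + 2 ∷ + 2 ∷ + 1 ∷ + 1 ∷ []) ∷
  (+ 1 ∷ + 2 ∷ + 3 ∷ + 2 ∷ + 1 ∷ + 2 ∷ []) ∷ []

Adj′ : Fin 6 → Fin 6 → ℤ
Adj′ i j = lookup (lookup adjugateQuotientRows i) j

τ : Fin 6 → ℤ
τ = lookup (+ 1 ∷ -[1+ 0 ] ∷ + 0 ∷ + 1 ∷ -[1+ 0 ] ∷ + 0 ∷ [])

-- Modulo 3 the adjugate has rank one: the discriminant group of E₆ is ℤ/3.
Adj≡3Adj′+ττ : ∀ i j → Adj i j ≡ + 3 ℤ.* Adj′ i j ℤ.+ τ i ℤ.* τ j
Adj≡3Adj′+ττ = toWitness {a? = all? λ i → all? λ j → Adj i j ℤ.≟ + 3 ℤ.* Adj′ i j ℤ.+ τ i ℤ.* τ j} _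

*-distribʳ-3+ : ∀ x y z w → (+ 3 ℤ.* x ℤ.+ y ℤ.* z) ℤ.* w ≡ + 3 ℤ.* (x ℤ.* w) ℤ.+ y ℤ.* (z ℤ.* w)
*-distribʳ-3+ x y z w = trans (ℤP.*-distribʳ-+ w (+ 3 ℤ.* x) (y ℤ.* z))
  (cong₂ ℤ._+_ (ℤP.*-assoc (+ 3) x w) (ℤP.*-assoc y z w))

module AdjugateApplied (m : Fin 6 → ℤ) where

  adj : Fin 6 → ℤ
  adj j = ℤΣ.sum (λ k → Adj j k ℤ.* m k)

  adj′ : Fin 6 → ℤ
  adj′ j = ℤΣ.sum (λ k → Adj′ j k ℤ.* m k)

  τ·m : ℤ
  τ·m = ℤΣ.sum (λ k → τ k ℤ.* m k)

  adj-split : ∀ j → adj j ≡ + 3 ℤ.* adj′ j ℤ.+ τ·m ℤ.* τ j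
  adj-split j = begin
    ℤΣ.sum (λ k → Adj j k ℤ.* m k)
      ≡⟨ ℤΣ.sum-cong-≗ (λ k → trans (cong (ℤ._* m k) (Adj≡3Adj′+ττ j k))
                                    (*-distribʳ-3+ (Adj′ j k) (τ j) (τ k) (m k))) ⟩
    ℤΣ.sum (λ k → + 3 ℤ.* (Adj′ j k ℤ.* m k) ℤ.+ τ j ℤ.* (τ k ℤ.* m k))
      ≡⟨ ℤΣ.∑-distrib-+ (λ k → + 3 ℤ.* (Adj′ j k ℤ.* m k)) (λ k → τ j ℤ.* (τ k ℤ.* m k)) ⟩
    ℤΣ.sum (λ k → + 3 ℤ.* (Adj′ j k ℤ.* m k)) ℤ.+ ℤΣ.sum (λ k → τ j ℤ.* (τ k ℤ.* m k))
      ≡⟨ sym (cong₂ ℤ._+_ (ℤΣ.*-distribˡ-sum (+ 3) (λ k → Adj′ j k ℤ.* m k))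
                          (ℤΣ.*-distribˡ-sum (τ j) (λ k → τ k ℤ.* m k))) ⟩
    + 3 ℤ.* adj′ j ℤ.+ τ j ℤ.* τ·m
      ≡⟨ cong (ℤ._+_ (+ 3 ℤ.* adj′ j)) (ℤP.*-comm (τ j) τ·m) ⟩
    + 3 ℤ.* adj′ j ℤ.+ τ·m ℤ.* τ j ∎
    where open ≡-Reasoning

  adj-form-split : ℤΣ.sum (λ j → adj j ℤ.* m j) ≡ + 3 ℤ.* ℤΣ.sum (λ j → adj′ j ℤ.* m j) ℤ.+ τ·m ℤ.* τ·m
  adj-form-split = begin
    ℤΣ.sum (λ j → adj j ℤ.* m j)
      ≡⟨ ℤΣ.sum-cong-≗ (λ j → trans (cong (ℤ._* m j) (adj-split j)) (*-distribʳ-3+ (adj′ j) τ·m (τ j) (m j))) ⟩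
    ℤΣ.sum (λ j → + 3 ℤ.* (adj′ j ℤ.* m j) ℤ.+ τ·m ℤ.* (τ j ℤ.* m j))
      ≡⟨ ℤΣ.∑-distrib-+ (λ j → + 3 ℤ.* (adj′ j ℤ.* m j)) (λ j → τ·m ℤ.* (τ j ℤ.* m j)) ⟩
    ℤΣ.sum (λ j → + 3 ℤ.* (adj′ j ℤ.* m j)) ℤ.+ ℤΣ.sum (λ j → τ·m ℤ.* (τ j ℤ.* m j))
      ≡⟨ sym (cong₂ ℤ._+_ (ℤΣ.*-distribˡ-sum (+ 3) (λ j → adj′ j ℤ.* m j))
                          (ℤΣ.*-distribˡ-sum τ·m (λ j → τ j ℤ.* m j))) ⟩
    + 3 ℤ.* ℤΣ.sum (λ j → adj′ j ℤ.* m j) ℤ.+ τ·m ℤ.* τ·m ∎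
    where open ≡-Reasoning

prime∣square⇒∣ : ∀ {p} x → Prime p → + p ∣ x ℤ.* x → + p ∣ x
prime∣square⇒∣ x p-prime p∣x² =
  ∣ᵤ⇒∣ (reduce (euclidsLemma ℤ.∣ x ∣ ℤ.∣ x ∣ p-prime (subst (_ ℕ∣_) (ℤP.abs-* x x) (∣⇒∣ᵤ p∣x²))))

Adj-b-e : ∀ z j → Σℚ 6 (λ k → ι (Adj j k) * b z (e k)) ≡ ι (+ 6) * z j
Adj-b-e z j = begin
  Σℚ 6 (λ k → ι (Adj j k) * b z (e k))
    ≡⟨ sum-cong-≗ (λ k → trans (cong (ι (Adj j k) *_) (b-e z k)) (*-distribˡ-sum (ι (Adj j k)) (λ i → z i * ι (Gram i k)))) ⟩
  Σℚ 6 (λ k → Σℚ 6 (λ i → ι (Adj j k) * (z i * ι (Gram i k))))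
    ≡⟨ ∑-comm (λ k i → ι (Adj j k) * (z i * ι (Gram i k))) ⟩
  Σℚ 6 (λ i → Σℚ 6 (λ k → ι (Adj j k) * (z i * ι (Gram i k))))
    ≡⟨ sum-cong-≗ (λ i → trans (sum-cong-≗ λ k → pull-z i k) (sym (*-distribˡ-sum (z i) (λ k → ι (Gram i k ℤ.* Adj j k))))) ⟩
  Σℚ 6 (λ i → z i * Σℚ 6 (λ k → ι (Gram i k ℤ.* Adj j k)))
    ≡⟨ sum-cong-≗ (λ i → cong (z i *_) (trans (ι-homo-sum 6 (λ k → Gram i k ℤ.* Adj j k)) (cong ι (Gram*Adj≡6 i j)))) ⟩
  Σℚ 6 (λ i → z i * ι (+ 6 ℤ.* δℤ i j))
    ≡⟨ sum-cong-≗ six-δ ⟩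
  Σℚ 6 (λ i → δ j i * (ι (+ 6) * z i))
    ≡⟨ ∑-δ 6 j (λ i → ι (+ 6) * z i) ⟩
  ι (+ 6) * z j ∎
  where
  open ≡-Reasoning
  rearrange : ∀ a x g → a * (x * g) ≡ x * (g * a)
  rearrange = solve 3 (λ a x g → a :* (x :* g) := x :* (g :* a)) refl
  pull-z : ∀ i k → ι (Adj j k) * (z i * ι (Gram i k)) ≡ z i * ι (Gram i k ℤ.* Adj j k)
  pull-z i k = trans (rearrange (ι (Adj j k)) (z i) (ι (Gram i k))) (cong (z i *_) (sym (ι-homo-* (Gram i k) (Adj j k))))
  six-δ : ∀ i → z i * ι (+ 6 ℤ.* δℤ i j) ≡ δ j i * (ι (+ 6) * z i)
  six-δ i = begin
    z i * ι (+ 6 ℤ.* δℤ i j)   ≡⟨ cong (z i *_) (trans (ι-homo-* (+ 6) (δℤ i j)) (cong (ι (+ 6) *_) (ι-δℤ i j))) ⟩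
    z i * (ι (+ 6) * δ i j)    ≡⟨ solve 3 (λ x c d → x :* (c :* d) := d :* (c :* x)) refl (z i) (ι (+ 6)) (δ i j) ⟩
    δ i j * (ι (+ 6) * z i)    ≡⟨ cong (_* (ι (+ 6) * z i)) (δ-sym i j) ⟩
    δ j i * (ι (+ 6) * z i)    ∎

dual-integral⇒half : ∀ z → (∀ k → IsInt (b z (e k))) → IsInt (b z z) → ∃ λ (u : ℤ⁶) → z ≈ (½ · ⟦ u ⟧)
dual-integral⇒half z z·e∈ℤ (N , z·z≡N) = tabulate w , λ t →
  trans (z≡½w t) (cong (λ x → ½ * ι x) (sym (VecP.lookup∘tabulate w t)))
  where
  m : Fin 6 → ℤ
  m k = proj₁ (z·e∈ℤ k)
  open AdjugateApplied m

  six-z : ∀ j → ι (+ 6) * z j ≡ ι (adj j)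
  six-z j = begin
    ι (+ 6) * z j
      ≡⟨ sym (Adj-b-e z j) ⟩
    Σℚ 6 (λ k → ι (Adj j k) * b z (e k))
      ≡⟨ sum-cong-≗ (λ k → trans (cong (ι (Adj j k) *_) (proj₂ (z·e∈ℤ k))) (sym (ι-homo-* (Adj j k) (m k)))) ⟩
    Σℚ 6 (λ k → ι (Adj j k ℤ.* m k))
      ≡⟨ ι-homo-sum 6 (λ k → Adj j k ℤ.* m k) ⟩
    ι (adj j) ∎
    where open ≡-Reasoning

  six-norm : + 3 ℤ.* (+ 2 ℤ.* N) ≡ ℤΣ.sum (λ j → adj j ℤ.* m j)
  six-norm = ι-injective (begin
    ι (+ 3 ℤ.* (+ 2 ℤ.* N))
      ≡⟨ cong ι (sym (ℤP.*-assoc (+ 3) (+ 2) N)) ⟩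
    ι (+ 6 ℤ.* N)
      ≡⟨ trans (ι-homo-* (+ 6) N) (cong (ι (+ 6) *_) (sym z·z≡N)) ⟩
    ι (+ 6) * b z z
      ≡⟨ cong (ι (+ 6) *_) (b-expandʳ z z) ⟩
    ι (+ 6) * Σℚ 6 (λ j → z j * b z (e j))
      ≡⟨ *-distribˡ-sum (ι (+ 6)) (λ j → z j * b z (e j)) ⟩
    Σℚ 6 (λ j → ι (+ 6) * (z j * b z (e j))) ≡⟨ sum-cong-≗ (λ j → trans (sym (ℚP.*-assoc (ι (+ 6)) (z j) (b z (e j))))
                                                 (trans (cong₂ _*_ (six-z j) (proj₂ (z·e∈ℤ j))) (sym (ι-homo-* (adj j) (m j))))) ⟩
    Σℚ 6 (λ j → ι (adj j ℤ.* m j))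
      ≡⟨ ι-homo-sum 6 (λ j → adj j ℤ.* m j) ⟩
    ι (ℤΣ.sum (λ j → adj j ℤ.* m j)) ∎)
    where open ≡-Reasoning

  3∣τ·m : + 3 ∣ τ·m
  3∣τ·m = prime∣square⇒∣ τ·m (from-yes (prime? 3)) (∣m+n∣m⇒∣n
    (subst (+ 3 ∣_) (trans six-norm adj-form-split) (∣m⇒∣m*n (+ 2 ℤ.* N) ∣-refl))
    (∣m⇒∣m*n (ℤΣ.sum (λ j → adj′ j ℤ.* m j)) ∣-refl))

  3∣adj : ∀ j → + 3 ∣ adj j
  3∣adj j = subst (+ 3 ∣_) (sym (adj-split j)) (∣m∣n⇒∣m+n (∣m⇒∣m*n (adj′ j) ∣-refl) (∣m⇒∣m*n (τ j) 3∣τ·m))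

  w : Fin 6 → ℤ
  w j = _∣_.quotient (3∣adj j)

  z≡½w : ∀ j → z j ≡ ½ * ι (w j)
  z≡½w j = begin
    z j
      ≡⟨ solve 1 (λ x → x := con (+ 1 / 6) :* (con (ι (+ 6)) :* x)) refl (z j) ⟩
    (+ 1 / 6) * (ι (+ 6) * z j)
      ≡⟨ cong ((+ 1 / 6) *_) (trans (six-z j) (trans (cong ι (_∣_.equality (3∣adj j))) (ι-homo-* (w j) (+ 3)))) ⟩
    (+ 1 / 6) * (ι (w j) * ι (+ 3))
      ≡⟨ solve 1 (λ x → con (+ 1 / 6) :* (x :* con (ι (+ 3))) := con ½ :* x) refl (ι (w j)) ⟩
    ½ * ι (w j) ∎
    where open ≡-Reasoning

integral⇒half : ∀ {L z} → Integral L → z ∈ L → ∃ λ u → z ≈ (½ · ⟦ u ⟧)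
integral⇒half {L} {z} int z∈L = dual-integral⇒half z (λ k → int z (e k) z∈L (e∈ {L} k)) (int z z z∈L z∈L)

-- Reflections in the roots eᵢ

b-ee : ∀ i → b (e i) (e i) ≡ ι (+ 4)
b-ee = toWitness {a? = all? λ i → b (e i) (e i) ℚP.≟ ι (+ 4)} _

-- v − (2 b(v, eᵢ) / b(eᵢ, eᵢ)) eᵢ, as b(eᵢ, eᵢ) = 4.
reflect : Fin 6 → V → V
reflect i v = v +ᵥ ((- (½ * b v (e i))) · e i)

reflect-linear : ∀ i → IsLinear (reflect i)
reflect-linear i = record
  { cong≈  = λ {v} {w} p t → cong₂ (λ x β → x + (- (½ * β)) * e i t) (p t) (b-cong p (≈-refl {e i}))
  ; homo-+ = λ v w t → trans (cong (λ β → (v t + w t) + (- (½ * β)) * e i t) (b-+ˡ v w (e i)))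
                              (additive (v t) (w t) (b v (e i)) (b w (e i)) (e i t))
  ; homo-· = λ q v t → trans (cong (λ β → q * v t + (- (½ * β)) * e i t) (b-·ˡ q v (e i)))
                              (homogeneous q (v t) (b v (e i)) (e i t))
  }
  where
  additive : ∀ x y β γ r → (x + y) + (- (½ * (β + γ))) * r ≡ (x + (- (½ * β)) * r) + (y + (- (½ * γ)) * r)
  additive = solve 5 (λ x y β γ r → (x :+ y) :+ (:- (con ½ :* (β :+ γ))) :* r
                                 := (x :+ (:- (con ½ :* β)) :* r) :+ (y :+ (:- (con ½ :* γ)) :* r)) refl
  homogeneous : ∀ q x β r → q * x + (- (½ * (q * β))) * r ≡ q * (x + (- (½ * β)) * r)
  homogeneous = solve 4 (λ q x β r → q :* x :+ (:- (con ½ :* (q :* β))) :* r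
                                  := q :* (x :+ (:- (con ½ :* β)) :* r)) refl

b-reflect-e : ∀ i v → b (reflect i v) (e i) ≡ - b v (e i)
b-reflect-e i v = begin
  b (reflect i v) (e i)
    ≡⟨ b-+ˡ v (c · e i) (e i) ⟩
  b v (e i) + b (c · e i) (e i)
    ≡⟨ cong (_+_ (b v (e i))) (trans (b-·ˡ c (e i) (e i)) (cong (c *_) (b-ee i))) ⟩
  b v (e i) + c * ι (+ 4)
    ≡⟨ solve 1 (λ β → β :+ (:- (con ½ :* β)) :* con (ι (+ 4)) := :- β) refl (b v (e i)) ⟩
  - b v (e i) ∎
  where
  open ≡-Reasoning
  c : ℚ
  c = - (½ * b v (e i))

reflect-b : ∀ i v w → b (reflect i v) (reflect i w) ≡ b v w
reflect-b i v w = begin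
  b (reflect i v) (w +ᵥ (cw · e i))
    ≡⟨ b-+ʳ (reflect i v) w (cw · e i) ⟩
  b (reflect i v) w + b (reflect i v) (cw · e i)
    ≡⟨ cong₂ _+_ (b-+ˡ v (cv · e i) w) (trans (b-·ʳ cw (reflect i v) (e i)) (cong (cw *_) (b-reflect-e i v))) ⟩
  (b v w + b (cv · e i) w) + cw * - b v (e i)
    ≡⟨ cong (λ β → (b v w + β) + cw * - b v (e i)) (trans (b-·ˡ cv (e i) w) (cong (cv *_) (b-sym (e i) w))) ⟩
  (b v w + cv * b w (e i)) + cw * - b v (e i)
    ≡⟨ solve 3 (λ β x y → (β :+ (:- (con ½ :* x)) :* y) :+ (:- (con ½ :* y)) :* (:- x) := β) refl
         (b v w) (b v (e i)) (b w (e i)) ⟩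
  b v w ∎
  where
  open ≡-Reasoning
  cv cw : ℚ
  cv = - (½ * b v (e i))
  cw = - (½ * b w (e i))

reflect-involutive : ∀ i v → reflect i (reflect i v) ≈ v
reflect-involutive i v t = begin
  (v t + c * e i t) + (- (½ * b (reflect i v) (e i))) * e i t
    ≡⟨ cong (λ β → (v t + c * e i t) + (- (½ * β)) * e i t) (b-reflect-e i v) ⟩
  (v t + c * e i t) + (- (½ * - b v (e i))) * e i t
    ≡⟨ solve 3 (λ x β r → (x :+ (:- (con ½ :* β)) :* r) :+ (:- (con ½ :* (:- β))) :* r := x) refl (v t) (b v (e i)) (e i t) ⟩
  v t ∎
  where
  open ≡-Reasoning
  c : ℚ
  c = - (½ * b v (e i))

reflection : Fin 6 → Isometry
reflection i = record
  { to = reflect i ; from = reflect i ; to-linear = reflect-linear i ; from-linear = reflect-linear i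
  ; to-b = reflect-b i ; from∘to = reflect-involutive i ; to∘from = reflect-involutive i }

-*0-identityʳ : ∀ x c → x ℤ.- c ℤ.* + 0 ≡ x
-*0-identityʳ x c rewrite ℤP.*-zeroʳ c = ℤP.+-identityʳ x

lookup-updateAt-δ : ∀ {n} (i t : Fin n) (u : Vec ℤ n) c →
  lookup (updateAt u i (ℤ._- c)) t ≡ lookup u t ℤ.- c ℤ.* δℤ i t
lookup-updateAt-δ zero    zero    (x ∷ u) c = cong (λ d → x ℤ.- d) (sym (ℤP.*-identityʳ c))
lookup-updateAt-δ zero    (suc t) (x ∷ u) c = sym (-*0-identityʳ (lookup u t) c)
lookup-updateAt-δ (suc i) zero    (x ∷ u) c = sym (-*0-identityʳ x c)
lookup-updateAt-δ (suc i) (suc t) (x ∷ u) c = lookup-updateAt-δ i t u c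

-- Only coordinate i moves; updateAt (unlike tabulate) keeps the evaluation of long words cheap.
reflectℤ : Fin 6 → ℤ⁶ → ℤ⁶
reflectℤ i u = updateAt u i (ℤ._- cartanCoord u i)

reflect-⟦⟧ : ∀ i u → reflect i ⟦ u ⟧ ≈ ⟦ reflectℤ i u ⟧
reflect-⟦⟧ i u t = begin
  ι (lookup u t) + (- (½ * b ⟦ u ⟧ (e i))) * δ i t
    ≡⟨ cong₂ (λ β d → ι (lookup u t) + (- (½ * β)) * d) (trans (b-⟦⟧-e u i) (ι-homo-* (+ 2) c)) (sym (ι-δℤ i t)) ⟩
  ι (lookup u t) + (- (½ * (ι (+ 2) * ι c))) * ι (δℤ i t)
    ≡⟨ solve 3 (λ x y d → x :+ (:- (con ½ :* (con (ι (+ 2)) :* y))) :* d := x :+ (:- (y :* d))) refl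
         (ι (lookup u t)) (ι c) (ι (δℤ i t)) ⟩
  ι (lookup u t) + - (ι c * ι (δℤ i t))
    ≡⟨ cong (λ x → ι (lookup u t) + x) (sym (trans (ι-homo‿- (c ℤ.* δℤ i t)) (cong -_ (ι-homo-* c (δℤ i t))))) ⟩
  ι (lookup u t) + ι (ℤ.- (c ℤ.* δℤ i t))
    ≡⟨ sym (ι-homo-+ (lookup u t) (ℤ.- (c ℤ.* δℤ i t))) ⟩
  ι (lookup u t ℤ.- c ℤ.* δℤ i t)
    ≡⟨ cong ι (sym (lookup-updateAt-δ i t u c)) ⟩
  ι (lookup (reflectℤ i u) t) ∎
  where
  open ≡-Reasoning
  c : ℤ
  c = cartanCoord u i

reflections : List (Fin 6) → Isometry
reflections []      = id-isometry
reflections (i ∷ w) = reflection i ∘ᵢ reflections w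

reflectWordℤ : List (Fin 6) → ℤ⁶ → ℤ⁶
reflectWordℤ []      u = u
reflectWordℤ (i ∷ w) u = reflectℤ i (reflectWordℤ w u)

reflectWordℤ⁻¹ : List (Fin 6) → ℤ⁶ → ℤ⁶
reflectWordℤ⁻¹ []      u = u
reflectWordℤ⁻¹ (i ∷ w) u = reflectWordℤ⁻¹ w (reflectℤ i u)

reflections-⟦⟧ : ∀ w u → Isometry.to (reflections w) ⟦ u ⟧ ≈ ⟦ reflectWordℤ w u ⟧
reflections-⟦⟧ []      u = ≈-refl
reflections-⟦⟧ (i ∷ w) u = ≈-trans (cong≈ (reflect-linear i) (reflections-⟦⟧ w u)) (reflect-⟦⟧ i (reflectWordℤ w u))

reflections⁻¹-⟦⟧ : ∀ w u → Isometry.from (reflections w) ⟦ u ⟧ ≈ ⟦ reflectWordℤ⁻¹ w u ⟧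
reflections⁻¹-⟦⟧ []      u = ≈-refl
reflections⁻¹-⟦⟧ (i ∷ w) u =
  ≈-trans (cong≈ (Isometry.from-linear (reflections w)) (reflect-⟦⟧ i u)) (reflections⁻¹-⟦⟧ w (reflectℤ i u))

e≈⟦⟧ : ∀ i → e i ≈ ⟦ tabulate (δℤ i) ⟧
e≈⟦⟧ i t = sym (trans (cong ι (VecP.lookup∘tabulate (δℤ i) t)) (ι-δℤ i t))

reflections-e∈ : ∀ {L} w i → Isometry.to (reflections w) (e i) ∈ L
reflections-e∈ {L} w i = ∈-resp-≈ {L}
  (≈-sym (≈-trans (cong≈ (Isometry.to-linear (reflections w)) (e≈⟦⟧ i)) (reflections-⟦⟧ w (tabulate (δℤ i)))))
  (ιᶠ∈ {L} (lookup (reflectWordℤ w (tabulate (δℤ i)))))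

reflections⁻¹-e∈ : ∀ {L} w i → Isometry.from (reflections w) (e i) ∈ L
reflections⁻¹-e∈ {L} w i = ∈-resp-≈ {L}
  (≈-sym (≈-trans (cong≈ (Isometry.from-linear (reflections w)) (e≈⟦⟧ i)) (reflections⁻¹-⟦⟧ w (tabulate (δℤ i)))))
  (ιᶠ∈ {L} (lookup (reflectWordℤ⁻¹ w (tabulate (δℤ i)))))

-- Lattices between Λ₆ and ½Λ₆

bitℤ : Bool → ℤ
bitℤ false = + 0
bitℤ true  = + 1

lift : Vec Bool 6 → ℤ⁶
lift = map bitℤ

halfVec : Vec Bool 6 → V
halfVec p = ½ · ⟦ lift p ⟧

lookup-lift : ∀ p t → lookup (lift p) t ≡ bitℤ (lookup p t)
lookup-lift p t = VecP.lookup-map t bitℤ p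

isOdd : ℤ → Bool
isOdd a = (a ℤ.%ℕ 2) ℕ.≡ᵇ 1

parity : ℤ⁶ → Vec Bool 6
parity = map isOdd

parity-split : ∀ a → a ≡ bitℤ (isOdd a) ℤ.+ (a ℤ./ℕ 2) ℤ.* + 2
parity-split a = trans (a≡a%ℕn+[a/ℕn]*n a 2) (cong (ℤ._+ (a ℤ./ℕ 2) ℤ.* + 2) (remainder-bit (a ℤ.%ℕ 2) (n%ℕd<d a 2)))
  where
  remainder-bit : ∀ m → m ℕ.< 2 → + m ≡ bitℤ (m ℕ.≡ᵇ 1)
  remainder-bit 0 _ = refl
  remainder-bit 1 _ = refl
  remainder-bit (suc (suc m)) (ℕ.s≤s (ℕ.s≤s ()))

half-parity : ∀ u → (½ · ⟦ u ⟧) ≈ (halfVec (parity u) +ᵥ ιᶠ (λ t → lookup u t ℤ./ℕ 2))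
half-parity u t = begin
  ½ * ι (lookup u t)              ≡⟨ cong (λ a → ½ * ι a) (parity-split (lookup u t)) ⟩
  ½ * ι (β ℤ.+ q ℤ.* + 2)         ≡⟨ cong (½ *_) (trans (ι-homo-+ β (q ℤ.* + 2)) (cong (_+_ (ι β)) (ι-homo-* q (+ 2)))) ⟩
  ½ * (ι β + ι q * ι (+ 2))       ≡⟨ solve 2 (λ x y → con ½ :* (x :+ y :* con (ι (+ 2))) := con ½ :* x :+ y) refl (ι β) (ι q) ⟩
  ½ * ι β + ι q                   ≡⟨ cong (λ γ → ½ * ι γ + ι q) (sym β≡) ⟩
  halfVec (parity u) t + ι q      ∎
  where
  open ≡-Reasoning
  q β : ℤ
  q = lookup u t ℤ./ℕ 2
  β = bitℤ (isOdd (lookup u t))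
  β≡ : lookup (lift (parity u)) t ≡ β
  β≡ = trans (lookup-lift (parity u) t) (cong bitℤ (VecP.lookup-map t isOdd u))

_⊕_ : Vec Bool 6 → Vec Bool 6 → Vec Bool 6
_⊕_ = zipWith _xor_

isZero : Vec Bool 6 → Bool
isZero p = isYes (VecP.≡-dec Bool._≟_ p (replicate 6 false))

inSpan : List (Vec Bool 6) → Vec Bool 6 → Bool
inSpan []       p = isZero p
inSpan (g ∷ gs) p = inSpan gs p ∨ inSpan gs (p ⊕ g)

halfGenerators : (gs : List (Vec Bool 6)) → Fin (length gs) → V
halfGenerators []       ()
halfGenerators (g ∷ gs) = halfVec g ∷ᶠ halfGenerators gs

halfLattice : List (Vec Bool 6) → Gens
halfLattice gs = gens (length gs) (halfGenerators gs)

halfVec-zero : halfVec (replicate 6 false) ≈ 0ᵥ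
halfVec-zero t = cong (λ β → ½ * ι β) (trans (lookup-lift (replicate 6 false) t) (cong bitℤ (VecP.lookup-replicate t false)))

carry : Bool → Bool → ℤ
carry false true = -[1+ 0 ]
carry _     _    = + 0

halfBit-split : ∀ x y → ½ * ι (bitℤ x) ≡ (½ * ι (bitℤ (x xor y)) + ι (carry x y)) + ½ * ι (bitℤ y)
halfBit-split false false = refl
halfBit-split false true  = refl
halfBit-split true  false = refl
halfBit-split true  true  = refl

halfVec-split : ∀ p g a → (halfVec p +ᵥ ιᶠ a) ≈
  ((halfVec (p ⊕ g) +ᵥ ιᶠ (λ t → a t ℤ.+ carry (lookup p t) (lookup g t))) +ᵥ halfVec g)
halfVec-split p g a t = begin
  ½ * ι (lookup (lift p) t) + ι (a t)
    ≡⟨ cong (λ β → ½ * ι β + ι (a t)) (lookup-lift p t) ⟩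
  ½ * ι (bitℤ x) + ι (a t)
    ≡⟨ cong (_+ ι (a t)) (halfBit-split x y) ⟩
  ((½ * ι (bitℤ (x xor y)) + ι (carry x y)) + ½ * ι (bitℤ y)) + ι (a t)
    ≡⟨ solve 4 (λ h c h′ α → ((h :+ c) :+ h′) :+ α := (h :+ (α :+ c)) :+ h′) refl
         (½ * ι (bitℤ (x xor y))) (ι (carry x y)) (½ * ι (bitℤ y)) (ι (a t)) ⟩
  (½ * ι (bitℤ (x xor y)) + (ι (a t) + ι (carry x y))) + ½ * ι (bitℤ y)
    ≡⟨ cong₂ (λ β γ → (½ * ι β + γ) + ½ * ι (bitℤ y))
         (sym (trans (lookup-lift (p ⊕ g) t) (cong bitℤ (VecP.lookup-zipWith _xor_ t p g))))
         (sym (ι-homo-+ (a t) (carry x y))) ⟩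
  (½ * ι (lookup (lift (p ⊕ g)) t) + ι (a t ℤ.+ carry x y)) + ½ * ι (bitℤ y)
    ≡⟨ cong (λ β → (½ * ι (lookup (lift (p ⊕ g)) t) + ι (a t ℤ.+ carry x y)) + ½ * ι β) (sym (lookup-lift g t)) ⟩
  (halfVec (p ⊕ g) t + ι (a t ℤ.+ carry x y)) + halfVec g t ∎
  where
  open ≡-Reasoning
  x y : Bool
  x = lookup p t
  y = lookup g t

inSpan-sound : ∀ gs p a → T (inSpan gs p) → (halfVec p +ᵥ ιᶠ a) ∈ halfLattice gs
inSpan-sound [] p a p≟0 with toWitness p≟0
... | refl = ∈-resp-≈ {halfLattice []} (λ t → sym (trans (cong (_+ ι (a t)) (halfVec-zero t)) (ℚP.+-identityˡ (ι (a t)))))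
               (ιᶠ∈ {halfLattice []} a)
inSpan-sound (g ∷ gs) p a p∈ with Equivalence.to T-∨ p∈
... | inj₁ p∈gs   = ∈-tail (halfGenerators (g ∷ gs)) (inSpan-sound gs p a p∈gs)
... | inj₂ p⊕g∈gs = ∈-resp-≈ {halfLattice (g ∷ gs)} (≈-sym (halfVec-split p g a))
  (∈-+ {halfLattice (g ∷ gs)}
    (∈-tail (halfGenerators (g ∷ gs)) (inSpan-sound gs (p ⊕ g) (λ t → a t ℤ.+ carry (lookup p t) (lookup g t)) p⊕g∈gs))
    (generator∈ (halfGenerators (g ∷ gs)) zero))

half∈halfLattice : ∀ gs u → T (inSpan gs (parity u)) → (½ · ⟦ u ⟧) ∈ halfLattice gs
half∈halfLattice gs u h =
  ∈-resp-≈ {halfLattice gs} (≈-sym (half-parity u)) (inSpan-sound gs (parity u) (λ t → lookup u t ℤ./ℕ 2) h)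

cartan : ℤ⁶ → ℤ⁶ → ℤ
cartan u v = ℤΣ.sum (λ i → cartanCoord u i ℤ.* lookup v i)

b-⟦⟧ : ∀ u v → b ⟦ u ⟧ ⟦ v ⟧ ≡ ι (+ 2 ℤ.* cartan u v)
b-⟦⟧ u v = begin
  b ⟦ u ⟧ ⟦ v ⟧
    ≡⟨ b-expandʳ ⟦ u ⟧ ⟦ v ⟧ ⟩
  Σℚ 6 (λ j → ι (lookup v j) * b ⟦ u ⟧ (e j))
    ≡⟨ sum-cong-≗ (λ j → trans (cong (ι (lookup v j) *_) (b-⟦⟧-e u j))
                                (sym (ι-homo-* (lookup v j) (+ 2 ℤ.* cartanCoord u j)))) ⟩
  Σℚ 6 (λ j → ι (lookup v j ℤ.* (+ 2 ℤ.* cartanCoord u j)))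
    ≡⟨ ι-homo-sum 6 (λ j → lookup v j ℤ.* (+ 2 ℤ.* cartanCoord u j)) ⟩
  ι (ℤΣ.sum (λ j → lookup v j ℤ.* (+ 2 ℤ.* cartanCoord u j)))
    ≡⟨ cong ι (ℤΣ.sum-cong-≗ λ j → exchange (lookup v j) (cartanCoord u j)) ⟩
  ι (ℤΣ.sum (λ j → + 2 ℤ.* (cartanCoord u j ℤ.* lookup v j)))
    ≡⟨ cong ι (sym (ℤΣ.*-distribˡ-sum (+ 2) (λ j → cartanCoord u j ℤ.* lookup v j))) ⟩
  ι (+ 2 ℤ.* cartan u v) ∎
  where
  open ≡-Reasoning
  exchange : ∀ x y → x ℤ.* (+ 2 ℤ.* y) ≡ + 2 ℤ.* (y ℤ.* x)
  exchange x y = trans (cong (x ℤ.*_) (ℤP.*-comm (+ 2) y)) (trans (sym (ℤP.*-assoc x y (+ 2)))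
    (trans (ℤP.*-comm (x ℤ.* y) (+ 2)) (cong (+ 2 ℤ.*_) (ℤP.*-comm x y))))

b-half : ∀ u v → b (½ · ⟦ u ⟧) (½ · ⟦ v ⟧) ≡ ½ * ι (cartan u v)
b-half u v = begin
  b (½ · ⟦ u ⟧) (½ · ⟦ v ⟧)
    ≡⟨ trans (b-·ˡ ½ ⟦ u ⟧ (½ · ⟦ v ⟧)) (cong (½ *_) (b-·ʳ ½ ⟦ u ⟧ ⟦ v ⟧)) ⟩
  ½ * (½ * b ⟦ u ⟧ ⟦ v ⟧)
    ≡⟨ cong (λ β → ½ * (½ * β)) (trans (b-⟦⟧ u v) (ι-homo-* (+ 2) (cartan u v))) ⟩
  ½ * (½ * (ι (+ 2) * ι (cartan u v)))
    ≡⟨ solve 1 (λ c → con ½ :* (con ½ :* (con (ι (+ 2)) :* c)) := con ½ :* c) refl (ι (cartan u v)) ⟩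
  ½ * ι (cartan u v) ∎
  where open ≡-Reasoning

half-integral⇒even : ∀ u v → IsInt (b (½ · ⟦ u ⟧) (½ · ⟦ v ⟧)) → + 2 ∣ cartan u v
half-integral⇒even u v (m , b≡m) = divides m (ι-injective (begin
  ι (cartan u v)                ≡⟨ solve 1 (λ c → c := con (ι (+ 2)) :* (con ½ :* c)) refl (ι (cartan u v)) ⟩
  ι (+ 2) * (½ * ι (cartan u v)) ≡⟨ cong (ι (+ 2) *_) (trans (sym (b-half u v)) b≡m) ⟩
  ι (+ 2) * ι m                 ≡⟨ trans (ℚP.*-comm (ι (+ 2)) (ι m)) (sym (ι-homo-* m (+ 2))) ⟩
  ι (m ℤ.* + 2)                 ∎))
  where open ≡-Reasoning

orthogonal : List (Vec Bool 6) → Vec Bool 6 → Bool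
orthogonal gs y = all (λ g → isYes (+ 2 ∣? cartan (lift y) (lift g))) gs

integral⇒orthogonal : ∀ y gs → Integral (halfLattice (y ∷ gs)) → T (orthogonal gs y)
integral⇒orthogonal y []       _   = _
integral⇒orthogonal y (g ∷ gs) int =
  Equivalence.from T-∧ (even , integral⇒orthogonal y gs (integral-⊆ {halfLattice (y ∷ gs)} {H} drop-g int))
  where
  hs : Fin (suc (suc (length gs))) → V
  hs = halfGenerators (y ∷ g ∷ gs)
  H : Gens
  H = halfLattice (y ∷ g ∷ gs)
  even : T (isYes (+ 2 ∣? cartan (lift y) (lift g)))
  even = fromWitness (half-integral⇒even (lift y) (lift g)
    (int (halfVec y) (halfVec g) (generator∈ hs zero) (generator∈ hs (suc zero))))
  drop-g : halfLattice (y ∷ gs) ⊆ H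
  drop-g = ⊆-by-generators {xs = halfGenerators (y ∷ gs)} {xs′ = hs}
    λ { zero → generator∈ hs zero ; (suc l) → generator∈ hs (suc (suc l)) }

all⇒halfGenerators : ∀ {P : V → Set} (p : Vec Bool 6 → Bool) → (∀ g → T (p g) → P (halfVec g)) →
  ∀ gs → T (all p gs) → ∀ l → P (halfGenerators gs l)
all⇒halfGenerators {P} p sound (g ∷ gs) h zero    = sound g (proj₁ (Equivalence.to T-∧ h))
all⇒halfGenerators {P} p sound (g ∷ gs) h (suc l) = all⇒halfGenerators {P} p sound gs (proj₂ (Equivalence.to T-∧ h)) l

≅-by-reflections : ∀ w gs gs′ →
  T (all (λ g → inSpan gs′ (parity (reflectWordℤ w (lift g)))) gs) →
  T (all (λ g → inSpan gs (parity (reflectWordℤ⁻¹ w (lift g)))) gs′) →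
  halfLattice gs ≅ halfLattice gs′
≅-by-reflections w gs gs′ forward backward = ≅-by-generators φ
  (reflections-e∈ w)
  (all⇒halfGenerators {λ v → to v ∈ halfLattice gs′} _ to-half∈ gs forward)
  (reflections⁻¹-e∈ w)
  (all⇒halfGenerators {λ v → from v ∈ halfLattice gs} _ from-half∈ gs′ backward)
  where
  φ : Isometry
  φ = reflections w
  open Isometry φ
  to-half : ∀ g → to (halfVec g) ≈ (½ · ⟦ reflectWordℤ w (lift g) ⟧)
  to-half g = ≈-trans (homo-· to-linear ½ ⟦ lift g ⟧) (·-cong ½ (reflections-⟦⟧ w (lift g)))
  from-half : ∀ g → from (halfVec g) ≈ (½ · ⟦ reflectWordℤ⁻¹ w (lift g) ⟧)
  from-half g = ≈-trans (homo-· from-linear ½ ⟦ lift g ⟧) (·-cong ½ (reflections⁻¹-⟦⟧ w (lift g)))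
  to-half∈ : ∀ g → T (inSpan gs′ (parity (reflectWordℤ w (lift g)))) → to (halfVec g) ∈ halfLattice gs′
  to-half∈ g h = ∈-resp-≈ {halfLattice gs′} (≈-sym (to-half g)) (half∈halfLattice gs′ _ h)
  from-half∈ : ∀ g → T (inSpan gs (parity (reflectWordℤ⁻¹ w (lift g)))) → from (halfVec g) ∈ halfLattice gs
  from-half∈ g h = ∈-resp-≈ {halfLattice gs} (≈-sym (from-half g)) (half∈halfLattice gs _ h)

-- Normal forms, certificates and the classification

indicator : List (Fin 6) → Vec Bool 6
indicator S = tabulate (λ i → any (λ j → isYes (i Fin.≟ j)) S)

normalGenerators : Fin 6 → List (Vec Bool 6)
normalGenerators zero                                = []
normalGenerators (suc zero)                          = indicator (# 0 ∷ []) ∷ []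
normalGenerators (suc (suc zero))                    = indicator (# 0 ∷ # 2 ∷ []) ∷ []
normalGenerators (suc (suc (suc zero)))              = indicator (# 0 ∷ []) ∷ indicator (# 2 ∷ []) ∷ []
normalGenerators (suc (suc (suc (suc zero))))        = indicator (# 0 ∷ # 2 ∷ []) ∷ indicator (# 0 ∷ # 4 ∷ []) ∷ []
normalGenerators (suc (suc (suc (suc (suc zero))))) =
  indicator (# 0 ∷ []) ∷ indicator (# 2 ∷ []) ∷ indicator (# 4 ∷ []) ∷ []

normalForm : Fin 6 → Gens
normalForm n = halfLattice (normalGenerators n)

certificateTable : Fin 6 → List (Vec Bool 6 × Fin 6 × List (Fin 6))
certificateTable zero =
  (indicator (# 5 ∷ []) , # 1 , # 1 ∷ # 2 ∷ # 5 ∷ # 0 ∷ # 1 ∷ # 2 ∷ []) ∷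
  (indicator (# 4 ∷ []) , # 1 , # 1 ∷ # 2 ∷ # 3 ∷ # 4 ∷ # 0 ∷ # 1 ∷ # 2 ∷ # 3 ∷ []) ∷
  (indicator (# 4 ∷ # 5 ∷ []) , # 2 , # 3 ∷ # 4 ∷ # 2 ∷ # 3 ∷ # 1 ∷ # 2 ∷ # 5 ∷ # 0 ∷ # 1 ∷ # 2 ∷ []) ∷
  (indicator (# 3 ∷ []) , # 1 , # 1 ∷ # 2 ∷ # 3 ∷ # 0 ∷ # 1 ∷ # 2 ∷ []) ∷
  (indicator (# 3 ∷ # 5 ∷ []) , # 2 , # 3 ∷ # 4 ∷ # 2 ∷ # 3 ∷ # 1 ∷ # 2 ∷ # 5 ∷ # 0 ∷ # 1 ∷ # 2 ∷ # 3 ∷ # 4 ∷ []) ∷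
  (indicator (# 3 ∷ # 4 ∷ []) , # 1 , # 1 ∷ # 2 ∷ # 3 ∷ # 4 ∷ # 0 ∷ # 1 ∷ # 2 ∷ []) ∷
  (indicator (# 3 ∷ # 4 ∷ # 5 ∷ []) , # 2 , # 3 ∷ # 4 ∷ # 2 ∷ # 3 ∷ # 1 ∷ # 2 ∷ # 5 ∷ # 0 ∷ # 1 ∷ # 2 ∷ # 3 ∷ []) ∷
  (indicator (# 2 ∷ []) , # 1 , # 1 ∷ # 2 ∷ # 0 ∷ # 1 ∷ []) ∷
  (indicator (# 2 ∷ # 5 ∷ []) , # 1 , # 1 ∷ # 2 ∷ # 5 ∷ # 0 ∷ # 1 ∷ []) ∷
  (indicator (# 2 ∷ # 4 ∷ []) , # 2 , # 3 ∷ # 4 ∷ # 2 ∷ # 3 ∷ # 1 ∷ # 2 ∷ # 0 ∷ # 1 ∷ []) ∷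
  (indicator (# 2 ∷ # 4 ∷ # 5 ∷ []) , # 2 , # 3 ∷ # 4 ∷ # 2 ∷ # 3 ∷ # 1 ∷ # 2 ∷ # 5 ∷ # 0 ∷ # 1 ∷ []) ∷
  (indicator (# 2 ∷ # 3 ∷ []) , # 1 , # 1 ∷ # 2 ∷ # 3 ∷ # 0 ∷ # 1 ∷ []) ∷
  (indicator (# 2 ∷ # 3 ∷ # 5 ∷ []) , # 1 , # 1 ∷ # 2 ∷ # 5 ∷ # 3 ∷ # 0 ∷ # 1 ∷ []) ∷
  (indicator (# 2 ∷ # 3 ∷ # 4 ∷ []) , # 1 , # 1 ∷ # 2 ∷ # 3 ∷ # 4 ∷ # 0 ∷ # 1 ∷ []) ∷
  (indicator (# 2 ∷ # 3 ∷ # 4 ∷ # 5 ∷ []) , # 1 , # 1 ∷ # 2 ∷ # 5 ∷ # 3 ∷ # 4 ∷ # 0 ∷ # 1 ∷ []) ∷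
  (indicator (# 1 ∷ []) , # 1 , # 1 ∷ # 0 ∷ []) ∷
  (indicator (# 1 ∷ # 5 ∷ []) , # 2 , # 5 ∷ # 2 ∷ # 1 ∷ # 0 ∷ []) ∷
  (indicator (# 1 ∷ # 4 ∷ []) , # 2 , # 3 ∷ # 4 ∷ # 2 ∷ # 3 ∷ # 1 ∷ # 0 ∷ []) ∷
  (indicator (# 1 ∷ # 4 ∷ # 5 ∷ []) , # 1 , # 1 ∷ # 2 ∷ # 5 ∷ # 3 ∷ # 4 ∷ # 2 ∷ # 3 ∷ # 0 ∷ []) ∷
  (indicator (# 1 ∷ # 3 ∷ []) , # 2 , # 3 ∷ # 2 ∷ # 1 ∷ # 0 ∷ []) ∷
  (indicator (# 1 ∷ # 3 ∷ # 5 ∷ []) , # 1 , # 1 ∷ # 2 ∷ # 5 ∷ # 3 ∷ # 2 ∷ # 0 ∷ []) ∷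
  (indicator (# 1 ∷ # 3 ∷ # 4 ∷ []) , # 2 , # 3 ∷ # 4 ∷ # 2 ∷ # 1 ∷ # 0 ∷ []) ∷
  (indicator (# 1 ∷ # 3 ∷ # 4 ∷ # 5 ∷ []) , # 1 , # 1 ∷ # 2 ∷ # 5 ∷ # 3 ∷ # 4 ∷ # 2 ∷ # 0 ∷ []) ∷
  (indicator (# 1 ∷ # 2 ∷ []) , # 1 , # 1 ∷ # 2 ∷ # 0 ∷ []) ∷
  (indicator (# 1 ∷ # 2 ∷ # 5 ∷ []) , # 1 , # 1 ∷ # 2 ∷ # 5 ∷ # 0 ∷ []) ∷
  (indicator (# 1 ∷ # 2 ∷ # 4 ∷ []) , # 2 , # 3 ∷ # 4 ∷ # 2 ∷ # 3 ∷ # 1 ∷ # 2 ∷ # 0 ∷ []) ∷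
  (indicator (# 1 ∷ # 2 ∷ # 4 ∷ # 5 ∷ []) , # 2 , # 3 ∷ # 4 ∷ # 2 ∷ # 3 ∷ # 1 ∷ # 2 ∷ # 5 ∷ # 0 ∷ []) ∷
  (indicator (# 1 ∷ # 2 ∷ # 3 ∷ []) , # 1 , # 1 ∷ # 2 ∷ # 3 ∷ # 0 ∷ []) ∷
  (indicator (# 1 ∷ # 2 ∷ # 3 ∷ # 5 ∷ []) , # 1 , # 1 ∷ # 2 ∷ # 5 ∷ # 3 ∷ # 0 ∷ []) ∷
  (indicator (# 1 ∷ # 2 ∷ # 3 ∷ # 4 ∷ []) , # 1 , # 1 ∷ # 2 ∷ # 3 ∷ # 4 ∷ # 0 ∷ []) ∷
  (indicator (# 1 ∷ # 2 ∷ # 3 ∷ # 4 ∷ # 5 ∷ []) , # 1 , # 1 ∷ # 2 ∷ # 5 ∷ # 3 ∷ # 4 ∷ # 0 ∷ []) ∷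
  (indicator (# 0 ∷ []) , # 1 , []) ∷
  (indicator (# 0 ∷ # 5 ∷ []) , # 2 , # 5 ∷ # 2 ∷ []) ∷
  (indicator (# 0 ∷ # 4 ∷ []) , # 2 , # 3 ∷ # 4 ∷ # 2 ∷ # 3 ∷ []) ∷
  (indicator (# 0 ∷ # 4 ∷ # 5 ∷ []) , # 1 , # 1 ∷ # 2 ∷ # 5 ∷ # 3 ∷ # 4 ∷ # 2 ∷ # 3 ∷ # 1 ∷ []) ∷
  (indicator (# 0 ∷ # 3 ∷ []) , # 2 , # 3 ∷ # 2 ∷ []) ∷
  (indicator (# 0 ∷ # 3 ∷ # 5 ∷ []) , # 1 , # 1 ∷ # 2 ∷ # 5 ∷ # 3 ∷ # 2 ∷ # 1 ∷ []) ∷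
  (indicator (# 0 ∷ # 3 ∷ # 4 ∷ []) , # 2 , # 3 ∷ # 4 ∷ # 2 ∷ []) ∷
  (indicator (# 0 ∷ # 3 ∷ # 4 ∷ # 5 ∷ []) , # 1 , # 1 ∷ # 2 ∷ # 5 ∷ # 3 ∷ # 4 ∷ # 2 ∷ # 1 ∷ []) ∷
  (indicator (# 0 ∷ # 2 ∷ []) , # 2 , []) ∷
  (indicator (# 0 ∷ # 2 ∷ # 5 ∷ []) , # 2 , # 5 ∷ []) ∷
  (indicator (# 0 ∷ # 2 ∷ # 4 ∷ []) , # 1 , # 1 ∷ # 2 ∷ # 5 ∷ # 3 ∷ # 4 ∷ # 2 ∷ # 3 ∷ # 1 ∷ # 2 ∷ # 5 ∷ []) ∷
  (indicator (# 0 ∷ # 2 ∷ # 4 ∷ # 5 ∷ []) , # 1 , # 1 ∷ # 2 ∷ # 5 ∷ # 3 ∷ # 4 ∷ # 2 ∷ # 3 ∷ # 1 ∷ # 2 ∷ []) ∷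
  (indicator (# 0 ∷ # 2 ∷ # 3 ∷ []) , # 2 , # 3 ∷ []) ∷
  (indicator (# 0 ∷ # 2 ∷ # 3 ∷ # 5 ∷ []) , # 2 , # 5 ∷ # 3 ∷ []) ∷
  (indicator (# 0 ∷ # 2 ∷ # 3 ∷ # 4 ∷ []) , # 2 , # 3 ∷ # 4 ∷ []) ∷
  (indicator (# 0 ∷ # 2 ∷ # 3 ∷ # 4 ∷ # 5 ∷ []) , # 2 , # 5 ∷ # 3 ∷ # 4 ∷ []) ∷
  (indicator (# 0 ∷ # 1 ∷ []) , # 1 , # 1 ∷ []) ∷
  (indicator (# 0 ∷ # 1 ∷ # 5 ∷ []) , # 2 , # 5 ∷ # 2 ∷ # 1 ∷ []) ∷
  (indicator (# 0 ∷ # 1 ∷ # 4 ∷ []) , # 2 , # 3 ∷ # 4 ∷ # 2 ∷ # 3 ∷ # 1 ∷ []) ∷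
  (indicator (# 0 ∷ # 1 ∷ # 4 ∷ # 5 ∷ []) , # 1 , # 1 ∷ # 2 ∷ # 5 ∷ # 3 ∷ # 4 ∷ # 2 ∷ # 3 ∷ []) ∷
  (indicator (# 0 ∷ # 1 ∷ # 3 ∷ []) , # 2 , # 3 ∷ # 2 ∷ # 1 ∷ []) ∷
  (indicator (# 0 ∷ # 1 ∷ # 3 ∷ # 5 ∷ []) , # 1 , # 1 ∷ # 2 ∷ # 5 ∷ # 3 ∷ # 2 ∷ []) ∷
  (indicator (# 0 ∷ # 1 ∷ # 3 ∷ # 4 ∷ []) , # 2 , # 3 ∷ # 4 ∷ # 2 ∷ # 1 ∷ []) ∷
  (indicator (# 0 ∷ # 1 ∷ # 3 ∷ # 4 ∷ # 5 ∷ []) , # 1 , # 1 ∷ # 2 ∷ # 5 ∷ # 3 ∷ # 4 ∷ # 2 ∷ []) ∷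
  (indicator (# 0 ∷ # 1 ∷ # 2 ∷ []) , # 1 , # 1 ∷ # 2 ∷ []) ∷
  (indicator (# 0 ∷ # 1 ∷ # 2 ∷ # 5 ∷ []) , # 1 , # 1 ∷ # 2 ∷ # 5 ∷ []) ∷
  (indicator (# 0 ∷ # 1 ∷ # 2 ∷ # 4 ∷ []) , # 2 , # 3 ∷ # 4 ∷ # 2 ∷ # 3 ∷ # 1 ∷ # 2 ∷ []) ∷
  (indicator (# 0 ∷ # 1 ∷ # 2 ∷ # 4 ∷ # 5 ∷ []) , # 2 , # 3 ∷ # 4 ∷ # 2 ∷ # 3 ∷ # 1 ∷ # 2 ∷ # 5 ∷ []) ∷
  (indicator (# 0 ∷ # 1 ∷ # 2 ∷ # 3 ∷ []) , # 1 , # 1 ∷ # 2 ∷ # 3 ∷ []) ∷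
  (indicator (# 0 ∷ # 1 ∷ # 2 ∷ # 3 ∷ # 5 ∷ []) , # 1 , # 1 ∷ # 2 ∷ # 5 ∷ # 3 ∷ []) ∷
  (indicator (# 0 ∷ # 1 ∷ # 2 ∷ # 3 ∷ # 4 ∷ []) , # 1 , # 1 ∷ # 2 ∷ # 3 ∷ # 4 ∷ []) ∷
  (indicator (# 0 ∷ # 1 ∷ # 2 ∷ # 3 ∷ # 4 ∷ # 5 ∷ []) , # 1 , # 1 ∷ # 2 ∷ # 5 ∷ # 3 ∷ # 4 ∷ []) ∷
  []
certificateTable (suc zero) =
  (indicator (# 5 ∷ []) , # 3 , # 5 ∷ # 2 ∷ []) ∷
  (indicator (# 4 ∷ []) , # 3 , # 3 ∷ # 4 ∷ # 2 ∷ # 3 ∷ []) ∷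
  (indicator (# 4 ∷ # 5 ∷ []) , # 3 , # 3 ∷ # 4 ∷ # 2 ∷ # 3 ∷ # 1 ∷ # 2 ∷ # 5 ∷ # 3 ∷ # 4 ∷ # 2 ∷ # 3 ∷ # 0 ∷ # 1 ∷ # 2 ∷ # 0 ∷ # 1 ∷ []) ∷
  (indicator (# 3 ∷ []) , # 3 , # 3 ∷ # 2 ∷ []) ∷
  (indicator (# 3 ∷ # 5 ∷ []) , # 3 , # 3 ∷ # 4 ∷ # 2 ∷ # 3 ∷ # 1 ∷ # 2 ∷ # 5 ∷ # 0 ∷ # 1 ∷ # 2 ∷ # 3 ∷ # 4 ∷ # 2 ∷ # 3 ∷ # 1 ∷ # 2 ∷ # 0 ∷ # 1 ∷ []) ∷
  (indicator (# 3 ∷ # 4 ∷ []) , # 3 , # 3 ∷ # 4 ∷ # 2 ∷ []) ∷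
  (indicator (# 3 ∷ # 4 ∷ # 5 ∷ []) , # 3 , # 3 ∷ # 4 ∷ # 2 ∷ # 3 ∷ # 1 ∷ # 2 ∷ # 5 ∷ # 3 ∷ # 4 ∷ # 0 ∷ # 1 ∷ # 2 ∷ # 3 ∷ # 1 ∷ # 2 ∷ # 0 ∷ # 1 ∷ []) ∷
  (indicator (# 2 ∷ []) , # 3 , []) ∷
  (indicator (# 2 ∷ # 5 ∷ []) , # 3 , # 5 ∷ []) ∷
  (indicator (# 2 ∷ # 4 ∷ []) , # 3 , # 5 ∷ # 3 ∷ # 4 ∷ # 1 ∷ # 2 ∷ # 3 ∷ # 0 ∷ # 1 ∷ # 2 ∷ # 5 ∷ # 2 ∷ # 3 ∷ # 1 ∷ # 2 ∷ # 0 ∷ # 1 ∷ []) ∷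
  (indicator (# 2 ∷ # 4 ∷ # 5 ∷ []) , # 3 , # 3 ∷ # 4 ∷ # 2 ∷ # 3 ∷ # 1 ∷ # 2 ∷ # 5 ∷ # 3 ∷ # 4 ∷ # 2 ∷ # 3 ∷ # 1 ∷ # 2 ∷ # 0 ∷ # 1 ∷ []) ∷
  (indicator (# 2 ∷ # 3 ∷ []) , # 3 , # 3 ∷ []) ∷
  (indicator (# 2 ∷ # 3 ∷ # 5 ∷ []) , # 3 , # 5 ∷ # 3 ∷ []) ∷
  (indicator (# 2 ∷ # 3 ∷ # 4 ∷ []) , # 3 , # 3 ∷ # 4 ∷ []) ∷
  (indicator (# 2 ∷ # 3 ∷ # 4 ∷ # 5 ∷ []) , # 3 , # 5 ∷ # 3 ∷ # 4 ∷ []) ∷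
  []
certificateTable (suc (suc zero)) =
  (indicator (# 4 ∷ []) , # 3 , # 5 ∷ # 3 ∷ # 4 ∷ # 1 ∷ # 2 ∷ # 3 ∷ # 0 ∷ # 1 ∷ # 2 ∷ # 5 ∷ # 4 ∷ # 3 ∷ []) ∷
  (indicator (# 3 ∷ # 5 ∷ []) , # 4 , # 5 ∷ # 2 ∷ # 3 ∷ # 4 ∷ # 2 ∷ # 3 ∷ []) ∷
  (indicator (# 3 ∷ # 4 ∷ # 5 ∷ []) , # 4 , # 5 ∷ # 3 ∷ # 4 ∷ # 2 ∷ # 3 ∷ []) ∷
  (indicator (# 2 ∷ []) , # 3 , []) ∷
  (indicator (# 2 ∷ # 4 ∷ []) , # 4 , []) ∷
  (indicator (# 2 ∷ # 3 ∷ # 5 ∷ []) , # 3 , # 3 ∷ # 1 ∷ # 2 ∷ # 5 ∷ # 2 ∷ # 3 ∷ # 0 ∷ # 1 ∷ []) ∷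
  (indicator (# 2 ∷ # 3 ∷ # 4 ∷ # 5 ∷ []) , # 3 , # 3 ∷ # 1 ∷ # 2 ∷ # 5 ∷ # 2 ∷ # 3 ∷ # 4 ∷ # 0 ∷ # 1 ∷ []) ∷
  (indicator (# 1 ∷ []) , # 3 , # 1 ∷ # 0 ∷ []) ∷
  (indicator (# 1 ∷ # 4 ∷ []) , # 4 , # 1 ∷ # 0 ∷ []) ∷
  (indicator (# 1 ∷ # 3 ∷ # 5 ∷ []) , # 3 , # 3 ∷ # 1 ∷ # 2 ∷ # 5 ∷ # 2 ∷ # 3 ∷ []) ∷
  (indicator (# 1 ∷ # 3 ∷ # 4 ∷ # 5 ∷ []) , # 3 , # 3 ∷ # 1 ∷ # 2 ∷ # 5 ∷ # 2 ∷ # 3 ∷ # 4 ∷ []) ∷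
  (indicator (# 1 ∷ # 2 ∷ []) , # 3 , # 1 ∷ []) ∷
  (indicator (# 1 ∷ # 2 ∷ # 4 ∷ []) , # 4 , # 1 ∷ []) ∷
  (indicator (# 1 ∷ # 2 ∷ # 3 ∷ # 5 ∷ []) , # 3 , # 3 ∷ # 1 ∷ # 2 ∷ # 5 ∷ # 2 ∷ # 3 ∷ # 0 ∷ []) ∷
  (indicator (# 1 ∷ # 2 ∷ # 3 ∷ # 4 ∷ # 5 ∷ []) , # 3 , # 3 ∷ # 1 ∷ # 2 ∷ # 5 ∷ # 2 ∷ # 3 ∷ # 4 ∷ # 0 ∷ []) ∷
  []
certificateTable (suc (suc (suc zero))) =
  (indicator (# 4 ∷ []) , # 5 , []) ∷
  (indicator (# 3 ∷ # 5 ∷ []) , # 5 , # 5 ∷ # 2 ∷ # 3 ∷ # 4 ∷ # 2 ∷ # 3 ∷ []) ∷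
  (indicator (# 3 ∷ # 4 ∷ # 5 ∷ []) , # 5 , # 5 ∷ # 3 ∷ # 4 ∷ # 2 ∷ # 3 ∷ []) ∷
  []
certificateTable (suc (suc (suc (suc zero)))) =
  (indicator (# 4 ∷ []) , # 5 , []) ∷
  (indicator (# 1 ∷ # 3 ∷ # 5 ∷ []) , # 5 , # 3 ∷ # 1 ∷ # 2 ∷ # 5 ∷ # 2 ∷ # 3 ∷ # 1 ∷ []) ∷
  (indicator (# 1 ∷ # 3 ∷ # 4 ∷ # 5 ∷ []) , # 5 , # 3 ∷ # 1 ∷ # 2 ∷ # 5 ∷ # 2 ∷ # 3 ∷ # 1 ∷ # 0 ∷ []) ∷
  []
certificateTable (suc (suc (suc (suc (suc zero))))) = []

certificate : Fin 6 → Vec Bool 6 → Fin 6 × List (Fin 6)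
certificate n y = search (certificateTable n)
  where
  -- An entry serves the whole coset key + span (normalGenerators n): both give the same lattice.
  search : List (Vec Bool 6 × Fin 6 × List (Fin 6)) → Fin 6 × List (Fin 6)
  search []                     = n , []
  search ((key , entry) ∷ rest) = if inSpan (normalGenerators n) (y ⊕ key) then entry else search rest

certifies : Fin 6 → Vec Bool 6 → Fin 6 × List (Fin 6) → Bool
certifies n y (n′ , w) =
  all (λ g → inSpan (normalGenerators n′) (parity (reflectWordℤ w (lift g)))) (y ∷ normalGenerators n) ∧
  all (λ g → inSpan (y ∷ normalGenerators n) (parity (reflectWordℤ⁻¹ w (lift g)))) (normalGenerators n′)

allVectors : ∀ m → (Vec Bool m → Bool) → Bool
allVectors zero    p = p []
allVectors (suc m) p = allVectors m (λ v → p (true ∷ v)) ∧ allVectors m (λ v → p (false ∷ v))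

allVectors-sound : ∀ m p → T (allVectors m p) → ∀ v → T (p v)
allVectors-sound zero    p h [] = h
allVectors-sound (suc m) p h (true ∷ v)  = allVectors-sound m (λ v → p (true ∷ v)) (proj₁ (Equivalence.to T-∧ h)) v
allVectors-sound (suc m) p h (false ∷ v) = allVectors-sound m (λ v → p (false ∷ v)) (proj₂ (Equivalence.to T-∧ h)) v

certified : Fin 6 → Vec Bool 6 → Bool
certified n y = not (orthogonal (normalGenerators n) y) ∨ certifies n y (certificate n y)

certificate-check-passes : ∀ n → T (allVectors 6 (certified n))
certificate-check-passes zero                                = tt
certificate-check-passes (suc zero)                          = tt
certificate-check-passes (suc (suc zero))                    = tt
certificate-check-passes (suc (suc (suc zero)))              = tt
certificate-check-passes (suc (suc (suc (suc zero))))        = tt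
certificate-check-passes (suc (suc (suc (suc (suc zero))))) = tt

certificate-valid : ∀ n y → T (orthogonal (normalGenerators n) y) → T (certifies n y (certificate n y))
certificate-valid n y orth with Equivalence.to T-∨ (allVectors-sound 6 (certified n) (certificate-check-passes n) y)
... | inj₁ not-orth = ⊥-elim (subst T (Equivalence.to T-not-≡ not-orth) orth)
... | inj₂ valid    = valid

certificate-≅ : ∀ n y → T (orthogonal (normalGenerators n) y) →
  halfLattice (y ∷ normalGenerators n) ≅ normalForm (proj₁ (certificate n y))
certificate-≅ n y orth with certificate n y | certificate-valid n y orth
... | n′ , w | valid = ≅-by-reflections w (y ∷ normalGenerators n) (normalGenerators n′)
  (proj₁ (Equivalence.to T-∧ valid)) (proj₂ (Equivalence.to T-∧ valid))

step : ∀ {j} (ys : Fin (suc j) → V) → Integral (gens (suc j) ys) →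
  ∀ n → gens j (tail ys) ≅ normalForm n → ∃ λ n′ → gens (suc j) ys ≅ normalForm n′
step ys int n I = proj₁ (certificate n y) , ≅-trans (≅-trans adjoin-z reduce-z) normalise
  where
  gs : List (Vec Bool 6)
  gs = normalGenerators n
  z : V
  z = _≅_.to I (ys zero)
  adjoin-z : gens _ ys ≅ gens _ (z ∷ᶠ halfGenerators gs)
  adjoin-z = ≅-extend I
  int⁺ : Integral (gens _ (z ∷ᶠ halfGenerators gs))
  int⁺ = ≅-integral adjoin-z int
  z-half : ∃ λ u → z ≈ (½ · ⟦ u ⟧)
  z-half = integral⇒half {gens _ (z ∷ᶠ halfGenerators gs)} int⁺ (generator∈ (z ∷ᶠ halfGenerators gs) zero)
  u : ℤ⁶
  u = proj₁ z-half
  y : Vec Bool 6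
  y = parity u
  reduce-z : gens _ (z ∷ᶠ halfGenerators gs) ≅ halfLattice (y ∷ gs)
  reduce-z = ≅-head-modΛ (λ t → lookup u t ℤ./ℕ 2) (≈-trans (proj₂ z-half) (half-parity u))
  normalise : halfLattice (y ∷ gs) ≅ normalForm (proj₁ (certificate n y))
  normalise = certificate-≅ n y (integral⇒orthogonal y gs (≅-integral reduce-z int⁺))

classify : ∀ j (ys : Fin j → V) → Integral (gens j ys) → ∃ λ n → gens j ys ≅ normalForm n
classify zero    ys int = zero , ≅-by-generators id-isometry (e∈ {normalForm zero}) (λ ()) (e∈ {gens 0 ys}) (λ ())
classify (suc j) ys int with classify j (tail ys) (integral-⊆ {gens j (tail ys)} {gens (suc j) ys} (∈-tail ys) int)
... | n , I = step ys int n I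

L[_] : Fin 6 → Gens
L[ zero ]                               = L0
L[ suc zero ]                           = L1
L[ suc (suc zero) ]                     = L2
L[ suc (suc (suc zero)) ]               = L3
L[ suc (suc (suc (suc zero))) ]         = L4
L[ suc (suc (suc (suc (suc zero)))) ]   = L5

≈-by-computation : ∀ {x y : V} → True (all? λ t → x t ℚP.≟ y t) → x ≈ y
≈-by-computation = toWitness

normalForm≅L : ∀ n → normalForm n ≅ L[ n ]
normalForm≅L zero = ≅-pointwise λ ()
normalForm≅L (suc zero) = ≅-pointwise λ { zero → ≈-by-computation tt }
normalForm≅L (suc (suc zero)) = ≅-pointwise λ { zero → ≈-by-computation tt }
normalForm≅L (suc (suc (suc zero))) =
  ≅-pointwise λ { zero → ≈-by-computation tt ; (suc zero) → ≈-by-computation tt }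
normalForm≅L (suc (suc (suc (suc zero)))) =
  ≅-pointwise λ { zero → ≈-by-computation tt ; (suc zero) → ≈-by-computation tt }
normalForm≅L (suc (suc (suc (suc (suc zero))))) =
  ≅-pointwise λ { zero → ≈-by-computation tt ; (suc zero) → ≈-by-computation tt ; (suc (suc zero)) → ≈-by-computation tt }

one-of-six : ∀ {M} n → Isometric M L[ n ] →
  Isometric M L0 ⊎ Isometric M L1 ⊎ Isometric M L2 ⊎ Isometric M L3 ⊎ Isometric M L4 ⊎ Isometric M L5
one-of-six zero                                = inj₁
one-of-six (suc zero)                          = inj₂ ∘ inj₁
one-of-six (suc (suc zero))                    = inj₂ ∘ inj₂ ∘ inj₁
one-of-six (suc (suc (suc zero)))              = inj₂ ∘ inj₂ ∘ inj₂ ∘ inj₁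
one-of-six (suc (suc (suc (suc zero))))        = inj₂ ∘ inj₂ ∘ inj₂ ∘ inj₂ ∘ inj₁
one-of-six (suc (suc (suc (suc (suc zero))))) = inj₂ ∘ inj₂ ∘ inj₂ ∘ inj₂ ∘ inj₂

theorem7p1 : (M : Gens) → Integral M →
    Isometric M L0 ⊎ Isometric M L1 ⊎ Isometric M L2 ⊎
    Isometric M L3 ⊎ Isometric M L4 ⊎ Isometric M L5
theorem7p1 M int with classify (k M) (xs M) int
... | n , M≅normal = one-of-six n (≅⇒Isometric (≅-trans M≅normal (normalForm≅L n)))
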